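{- There is a sequence of polynomials $p_0(x),p_1(x),\ldots$ such that for all $k\ge0$, $$A_{2n}^{=n+k}=p_k(n)\,(2n-1)!!\quad\text{for all } n\ge k+1.$$ Moreover $p_0(x)=1$, and for $k\ge1$ the values $p_k(n)$ are given by the recursion $$p_k(n)=\frac{B_{2k+1}(1)}{(2k+1)!!}+\sum_{j=1}^k\sum_{t=k+2}^n\frac{B_{2j+1}(1)\,2^j\,(t-1)\!\downarrow_j}{(2j+1)!}\,p_{k-j}(t-j-1).$$
   Context: For $\sigma=\sigma_1\ldots\sigma_n\in S_n$, let $\mathrm{mmp}^{(1,0,0,0)}(\sigma)$ be the number of indices $i$ such that there exists $j>i$ with $\sigma_j>\sigma_i$. $UD_n$ is the set of up-down permutations in $S_n$ ($\sigma_1<\sigma_2>\sigma_3<\sigma_4>\cdots$). $A_{2n}^{=m}$ denotes the number of $\sigma\in UD_{2n}$ with $\mathrm{mmp}^{(1,0,0,0)}(\sigma)=m$. $B_{2j+1}(1)=|UD_{2j+1}|$ is the number of up-down permutations of length $2j+1$. $(2n-1)!!=\prod_{i=1}^n(2i-1)$, and $(y)\!\downarrow_j=y(y-1)\cdots(y-j+1)$ for $j\ge1$, $(y)\!\downarrow_0=1$. -}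

module Defs where

open import Data.Bool using (Bool; true; false; _∧_; _∨_; not; if_then_else_)
open import Data.Nat as ℕ using (ℕ; zero; suc; _∸_; _<ᵇ_; _≡ᵇ_; NonZero)
open import Data.Nat.Properties using (m*n≢0)
open import Data.List using (List; []; _∷_; length; map; filterᵇ; upTo; foldr; concatMap)
open import Data.Bool.ListAction using (any)
open import Data.Integer using (+_)
open import Data.Rational using (ℚ; _/_; _+_; _*_; 0ℚ; 1ℚ)

-- Permutations of length m, represented as words σ₁ … σₘ (lists) over
-- the values {0,…,m-1} with pairwise distinct entries.  (Values are
-- shifted down by one from the paper's {1,…,m}; only comparisons
-- between entries matter below.)

words : ℕ → ℕ → List (List ℕ)
words m zero    = [] ∷ []
words m (suc k) = concatMap (λ a → map (a ∷_) (words m k)) (upTo m)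

distinct : List ℕ → Bool
distinct []       = true
distinct (x ∷ xs) = not (any (λ y → x ≡ᵇ y) xs) ∧ distinct xs

perms : ℕ → List (List ℕ)
perms m = filterᵇ distinct (words m m)

mutual
  ascAt : List ℕ → Bool
  ascAt (a ∷ b ∷ r) = (a <ᵇ b) ∧ descAt (b ∷ r)
  ascAt _           = true

  descAt : List ℕ → Bool
  descAt (a ∷ b ∷ r) = (b <ᵇ a) ∧ ascAt (b ∷ r)
  descAt _           = true

isUpDown : List ℕ → Bool
isUpDown = ascAt

mmp1000 : List ℕ → ℕ
mmp1000 []       = 0
mmp1000 (x ∷ xs) = (if any (λ y → x <ᵇ y) xs then 1 else 0) ℕ.+ mmp1000 xs

A= : ℕ → ℕ → ℕ
A= n m = length (filterᵇ (λ σ → isUpDown σ ∧ (mmp1000 σ ≡ᵇ m)) (perms (2 ℕ.* n)))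

-- B_{2j+1}(1) = |UD_{2j+1}|
B1 : ℕ → ℕ
B1 j = length (filterᵇ isUpDown (perms (suc (2 ℕ.* j))))

-- (2n-1)!! = ∏_{i=1}^n (2i-1)

dfact : ℕ → ℕ
dfact zero    = 1
dfact (suc n) = suc (2 ℕ.* n) ℕ.* dfact n

dfact-nz : ∀ n → NonZero (dfact n)
dfact-nz zero    = _
dfact-nz (suc n) = m*n≢0 (suc (2 ℕ.* n)) (dfact n) {{_}} {{dfact-nz n}}

fact-nz : ∀ n → NonZero (n ℕ.!)
fact-nz zero    = _
fact-nz (suc n) = m*n≢0 (suc n) (n ℕ.!) {{_}} {{fact-nz n}}

fall : ℕ → ℕ → ℕ
fall y zero    = 1
fall y (suc j) = fall y j ℕ.* (y ∸ j)

ℕ→ℚ : ℕ → ℚ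
ℕ→ℚ n = + n / 1

sumFT : ℕ → ℕ → (ℕ → ℚ) → ℚ
sumFT a b f = foldr (λ t acc → f t + acc) 0ℚ (map (a ℕ.+_) (upTo (suc b ∸ a)))

-- Polynomials with rational coefficients: coefficient lists
-- c₀ ∷ c₁ ∷ … (constant term first), and evaluation.

Poly : Set
Poly = List ℚ

eval : Poly → ℚ → ℚ
eval []       x = 0ℚ
eval (c ∷ cs) x = c + x * eval cs x

leadTerm : ℕ → ℚ
leadTerm k = (+ B1 k / dfact (suc k)) {{dfact-nz (suc k)}}

recRHS : (ℕ → Poly) → ℕ → ℕ → ℚ
recRHS p k n =
  leadTerm k +
  sumFT 1 k (λ j → sumFT (k ℕ.+ 2) n (λ t →
    (+ (B1 j ℕ.* (2 ℕ.^ j) ℕ.* fall (t ∸ 1) j) / (suc (2 ℕ.* j)) ℕ.!) {{fact-nz (suc (2 ℕ.* j))}}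
      * eval (p (k ∸ j)) (ℕ→ℚ (t ∸ j ∸ 1))))

-- Decompose an up-down permutation at its largest letter M: M must follow an alternating
-- prefix of odd length 2j + 1, every letter of that prefix has a larger letter (M) after it,
-- and M itself has none, so mmp(σ) = 2j + 1 + mmp(suffix).  Summing over the choice of the
-- prefix letters gives, for α_k(n) = A_{2n}^{=n+k},
--   α_k(n+1) = (2n+1) α_k(n) + Σ_{j=1}^{k} C(2n+1, 2j+1) B_{2j+1}(1) α_{k-j}(n-j),
-- where j > k is excluded because an alternating suffix of length 2m has mmp ≥ m.
-- Dividing by (2n+1)!! turns this into p_k(n+1) - p_k(n) = a polynomial in n built from
-- p_0, …, p_{k-1}, so p_k is an indefinite sum of a polynomial, normalised by its value
-- p_k(k+1) = B_{2k+1}(1)/(2k+1)!! coming from α_k(k+1) = B_{2k+1}(1).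
-- Permutations are counted as words of distinct letters over an arbitrary finite set of
-- unused letters; only relative order matters, which makes the decomposition recursive.

module Submission where

open import Algebra.Bundles using (CommutativeSemiring)

module NatBool where

  open import Data.Bool using (true; false; T; if_then_else_)
  open import Data.Bool.Properties using (T-≡)
  open import Data.Empty using (⊥; ⊥-elim)
  open import Data.Nat
  open import Data.Nat.Properties
  open import Data.Unit using (tt)
  open import Function.Base using (_∘′_)
  open import Function.Bundles using (Equivalence)
  open import Relation.Binary.PropositionalEquality

  private
    T⇒≡true : ∀ {b} → T b → b ≡ true
    T⇒≡true = Equivalence.to T-≡

    false-if-¬T : ∀ b → (T b → ⊥) → b ≡ false
    false-if-¬T false _ = refl
    false-if-¬T true  ¬t = ⊥-elim (¬t tt)

  ≡ᵇ-refl : ∀ n → (n ≡ᵇ n) ≡ true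
  ≡ᵇ-refl n = T⇒≡true (≡⇒≡ᵇ n n refl)

  ≡ᵇ-sym : ∀ m n → (m ≡ᵇ n) ≡ (n ≡ᵇ m)
  ≡ᵇ-sym zero    zero    = refl
  ≡ᵇ-sym zero    (suc n) = refl
  ≡ᵇ-sym (suc m) zero    = refl
  ≡ᵇ-sym (suc m) (suc n) = ≡ᵇ-sym m n

  ≢⇒≡ᵇ-false : ∀ {m n} → m ≢ n → (m ≡ᵇ n) ≡ false
  ≢⇒≡ᵇ-false {m} {n} m≢n = false-if-¬T (m ≡ᵇ n) (m≢n ∘′ ≡ᵇ⇒≡ m n)

  <⇒<ᵇ-true : ∀ {m n} → m < n → (m <ᵇ n) ≡ true
  <⇒<ᵇ-true m<n = T⇒≡true (<⇒<ᵇ m<n)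

  ≥⇒<ᵇ-false : ∀ {m n} → n ≤ m → (m <ᵇ n) ≡ false
  ≥⇒<ᵇ-false {m} {n} n≤m = false-if-¬T (m <ᵇ n) (λ t → <⇒≱ (<ᵇ⇒< m n t) n≤m)

  ≤⇒≤ᵇ-true : ∀ {m n} → m ≤ n → (m ≤ᵇ n) ≡ true
  ≤⇒≤ᵇ-true m≤n = T⇒≡true (≤⇒≤ᵇ m≤n)

  ≤ᵇ-true⇒≤ : ∀ m n → (m ≤ᵇ n) ≡ true → m ≤ n
  ≤ᵇ-true⇒≤ m n eq = ≤ᵇ⇒≤ m n (subst T (sym eq) tt)

  ≤ᵇ-suc : ∀ m n → (m ≤ᵇ n) ≡ (suc m ≤ᵇ suc n)
  ≤ᵇ-suc zero    n = refl
  ≤ᵇ-suc (suc m) n = refl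

  +-≡ᵇ-shift : ∀ s y c → ((s + y) ≡ᵇ c) ≡ (if s ≤ᵇ c then (y ≡ᵇ (c ∸ s)) else false)
  +-≡ᵇ-shift zero    y c       = refl
  +-≡ᵇ-shift (suc s) y zero    = refl
  +-≡ᵇ-shift (suc s) y (suc c) = trans (+-≡ᵇ-shift s y c) (cong (λ b → if b then (y ≡ᵇ (c ∸ s)) else false) (≤ᵇ-suc s c))

module RangeSum {c ℓ} (R : CommutativeSemiring c ℓ) where

  open CommutativeSemiring R
  open import Algebra.Properties.CommutativeSemigroup +-commutativeSemigroup using (interchange)
  open import Data.Bool using (false; if_then_else_)
  open import Data.Nat as ℕ using (ℕ; zero; suc; _<_; _≡ᵇ_)
  import Data.Nat.Properties as ℕ
  open import Data.Sum using (inj₁; inj₂)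
  open NatBool using (≡ᵇ-refl; ≢⇒≡ᵇ-false)
  import Relation.Binary.PropositionalEquality as ≡
  open import Relation.Binary.Reasoning.Setoid setoid

  ∑< : ℕ → (ℕ → Carrier) → Carrier
  ∑< zero    f = 0#
  ∑< (suc n) f = ∑< n f + f n

  syntax ∑< n (λ i → x) = ∑[ i < n ] x

  ∑-cong : ∀ n {f g : ℕ → Carrier} → (∀ i → i < n → f i ≈ g i) → ∑< n f ≈ ∑< n g
  ∑-cong zero    f≈g = refl
  ∑-cong (suc n) f≈g = +-cong (∑-cong n λ i i<n → f≈g i (ℕ.m<n⇒m<1+n i<n)) (f≈g n ℕ.≤-refl)

  ∑-zero : ∀ n {f : ℕ → Carrier} → (∀ i → i < n → f i ≈ 0#) → ∑< n f ≈ 0#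
  ∑-zero zero    f≈0 = refl
  ∑-zero (suc n) f≈0 =
    trans (+-cong (∑-zero n λ i i<n → f≈0 i (ℕ.m<n⇒m<1+n i<n)) (f≈0 n ℕ.≤-refl)) (+-identityˡ 0#)

  ∑-head : ∀ n f → ∑< (suc n) f ≈ f 0 + ∑[ i < n ] f (suc i)
  ∑-head zero    f = trans (+-identityˡ (f 0)) (sym (+-identityʳ (f 0)))
  ∑-head (suc n) f = trans (+-congʳ (∑-head n f)) (+-assoc (f 0) _ _)

  ∑-split : ∀ m n f → ∑< (m ℕ.+ n) f ≈ ∑< m f + ∑[ r < n ] f (m ℕ.+ r)
  ∑-split m zero    f rewrite ℕ.+-identityʳ m = sym (+-identityʳ _)
  ∑-split m (suc n) f rewrite ℕ.+-suc m n = trans (+-congʳ (∑-split m n f)) (+-assoc _ _ _)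

  ∑-distrib-+ : ∀ n f g → ∑[ i < n ] (f i + g i) ≈ ∑< n f + ∑< n g
  ∑-distrib-+ zero    f g = sym (+-identityˡ 0#)
  ∑-distrib-+ (suc n) f g = trans (+-congʳ (∑-distrib-+ n f g)) (interchange _ _ _ _)

  ∑-distribˡ : ∀ n x f → ∑[ i < n ] (x * f i) ≈ x * ∑< n f
  ∑-distribˡ zero    x f = sym (zeroʳ x)
  ∑-distribˡ (suc n) x f = trans (+-congʳ (∑-distribˡ n x f)) (sym (distribˡ x _ _))

  ∑-distribʳ : ∀ n x f → ∑< n f * x ≈ ∑[ i < n ] (f i * x)
  ∑-distribʳ zero    x f = zeroˡ x
  ∑-distribʳ (suc n) x f = trans (distribʳ x _ _) (+-congʳ (∑-distribʳ n x f))

  ∑-comm : ∀ m n (F : ℕ → ℕ → Carrier) → ∑[ a < m ] ∑[ l < n ] F a l ≈ ∑[ l < n ] ∑[ a < m ] F a l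
  ∑-comm m zero    F = ∑-zero m λ _ _ → refl
  ∑-comm m (suc n) F = trans (∑-distrib-+ m _ _) (+-congʳ (∑-comm m n F))

  ∑-extract : ∀ m M f → M < m → ∑< m f ≈ f M + ∑[ a < m ] (if a ≡ᵇ M then 0# else f a)
  ∑-extract (suc m) M f M<1+m with ℕ.m≤n⇒m<n∨m≡n (ℕ.≤-pred M<1+m)
  ... | inj₁ M<m = begin
    ∑< m f + f m                         ≈⟨ +-congʳ (∑-extract m M f M<m) ⟩
    f M + ∑< m g + f m                    ≈⟨ +-assoc _ _ _ ⟩
    f M + (∑< m g + f m)                  ≈⟨ +-congˡ (+-congˡ (reflexive (≡.cong (λ b → if b then 0# else f m) m≢ᵇM))) ⟨
    f M + ∑< (suc m) g                    ∎
    where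
    g : ℕ → Carrier
    g a = if a ≡ᵇ M then 0# else f a
    m≢ᵇM : (m ≡ᵇ M) ≡.≡ false
    m≢ᵇM = ≢⇒≡ᵇ-false (ℕ.>⇒≢ M<m)
  ... | inj₂ ≡.refl = begin
    ∑< m f + f M                          ≈⟨ +-comm _ _ ⟩
    f M + ∑< m f                          ≈⟨ +-congˡ (∑-cong m λ a a<M → reflexive (≡.cong (λ b → if b then 0# else f a) (≡.sym (≢⇒≡ᵇ-false (ℕ.<⇒≢ a<M))))) ⟩
    f M + ∑< m g                          ≈⟨ +-congˡ (+-identityʳ _) ⟨
    f M + (∑< m g + 0#)                   ≈⟨ +-congˡ (+-congˡ (reflexive (≡.cong (λ b → if b then 0# else f M) (≡ᵇ-refl M)))) ⟨
    f M + ∑< (suc m) g                    ∎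
    where
    g : ℕ → Carrier
    g a = if a ≡ᵇ M then 0# else f a

module Binomial where

  open import Data.Nat
  open import Data.Nat.Properties
  open import Data.Nat.Combinatorics using (_C_; nCk≡n!/k![n-k]!; k![n∸k]!∣n!)
  open import Data.Nat.DivMod using (m/n*n≡m)
  open import Data.Nat.Solver using (module +-*-Solver)
  open import Relation.Binary.PropositionalEquality
  open +-*-Solver

  nCk*[k!*[n∸k]!]≡n! : ∀ {n k} → k ≤ n → (n C k) * (k ! * (n ∸ k) !) ≡ n !
  nCk*[k!*[n∸k]!]≡n! {n} {k} k≤n = begin
    (n C k) * (k ! * (n ∸ k) !)            ≡⟨ cong (_* (k ! * (n ∸ k) !)) (nCk≡n!/k![n-k]! k≤n) ⟩
    n ! / (k ! * (n ∸ k) !) * (k ! * (n ∸ k) !) ≡⟨ m/n*n≡m (k![n∸k]!∣n! k≤n) ⟩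
    n !                                   ∎
    where
    open ≡-Reasoning
    instance _ = k !* (n ∸ k) !≢0

  nCj*[n∸j]C[l∸j]≡nCl*lCj : ∀ n l j → j ≤ l → l ≤ n → (n C j) * ((n ∸ j) C (l ∸ j)) ≡ (n C l) * (l C j)
  nCj*[n∸j]C[l∸j]≡nCl*lCj n l j j≤l l≤n =
    *-cancelʳ-≡ _ _ (j ! * ((l ∸ j) ! * (n ∸ l) !)) {{denominator≢0}} (trans viaJ (sym viaL))
    where
    open ≡-Reasoning
    denominator≢0 : NonZero (j ! * ((l ∸ j) ! * (n ∸ l) !))
    denominator≢0 = m*n≢0 (j !) _ {{j !≢0}} {{(l ∸ j) !* (n ∸ l) !≢0}}
    [n∸j]∸[l∸j]≡n∸l : (n ∸ j) ∸ (l ∸ j) ≡ n ∸ l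
    [n∸j]∸[l∸j]≡n∸l = trans (∸-+-assoc n j (l ∸ j)) (cong (n ∸_) (m+[n∸m]≡n j≤l))
    viaJ : (n C j) * ((n ∸ j) C (l ∸ j)) * (j ! * ((l ∸ j) ! * (n ∸ l) !)) ≡ n !
    viaJ = begin
      (n C j) * ((n ∸ j) C (l ∸ j)) * (j ! * ((l ∸ j) ! * (n ∸ l) !))
        ≡⟨ solve 5 (λ a b c d e → a :* b :* (c :* (d :* e)) := a :* (c :* (b :* (d :* e)))) refl
             (n C j) ((n ∸ j) C (l ∸ j)) (j !) ((l ∸ j) !) ((n ∸ l) !) ⟩
      (n C j) * (j ! * (((n ∸ j) C (l ∸ j)) * ((l ∸ j) ! * (n ∸ l) !)))
        ≡⟨ cong (λ z → (n C j) * (j ! * (((n ∸ j) C (l ∸ j)) * ((l ∸ j) ! * z !)))) (sym [n∸j]∸[l∸j]≡n∸l) ⟩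
      (n C j) * (j ! * (((n ∸ j) C (l ∸ j)) * ((l ∸ j) ! * ((n ∸ j) ∸ (l ∸ j)) !)))
        ≡⟨ cong (λ z → (n C j) * (j ! * z)) (nCk*[k!*[n∸k]!]≡n! (∸-monoˡ-≤ j l≤n)) ⟩
      (n C j) * (j ! * (n ∸ j) !)
        ≡⟨ nCk*[k!*[n∸k]!]≡n! (≤-trans j≤l l≤n) ⟩
      n ! ∎
    viaL : (n C l) * (l C j) * (j ! * ((l ∸ j) ! * (n ∸ l) !)) ≡ n !
    viaL = begin
      (n C l) * (l C j) * (j ! * ((l ∸ j) ! * (n ∸ l) !))
        ≡⟨ solve 5 (λ a b c d e → a :* b :* (c :* (d :* e)) := a :* (b :* (c :* d) :* e)) refl
             (n C l) (l C j) (j !) ((l ∸ j) !) ((n ∸ l) !) ⟩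
      (n C l) * ((l C j) * (j ! * (l ∸ j) !) * (n ∸ l) !)
        ≡⟨ cong (λ z → (n C l) * (z * (n ∸ l) !)) (nCk*[k!*[n∸k]!]≡n! j≤l) ⟩
      (n C l) * (l ! * (n ∸ l) !)
        ≡⟨ nCk*[k!*[n∸k]!]≡n! l≤n ⟩
      n ! ∎

module FreshWords where

  open import Data.Bool using (Bool; true; false; _∧_; _∨_; not; if_then_else_)
  open import Data.Bool.Properties using (∨-assoc; ∨-comm; ∨-zeroʳ; ∧-zeroʳ; ∨-conicalˡ; ∨-conicalʳ)
  open import Data.Bool.ListAction using (any)
  open import Data.List using (List; []; _∷_; length; map; filterᵇ; upTo; concatMap; _++_)
  open import Data.List.Properties using (upTo-∷ʳ; concatMap-++; ++-identityʳ)
  open import Data.List.Relation.Unary.All using (All; []; _∷_)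
  open import Data.Nat
  open import Data.Nat.Properties
  open import Data.Product using (_×_; _,_)
  open import Function using (_∘_)
  open import Relation.Binary.PropositionalEquality
  open import Defs using (words; distinct; perms)
  open NatBool
  open RangeSum +-*-commutativeSemiring

  Used : Set
  Used = ℕ → Bool

  mark : ℕ → Used → Used
  mark a U b = (b ≡ᵇ a) ∨ U b

  nothingUsed : Used
  nothingUsed _ = false

  _⊆ᵘ_ : Used → Used → Set
  U ⊆ᵘ V = ∀ b → U b ≡ true → V b ≡ true

  FreshWord : ℕ → Used → List ℕ → Set
  FreshWord m U = All (λ b → U b ≡ false × b < m)

  -- Sum of f (U ∪ w) w over the words w of k distinct letters below m avoiding U.
  sumFresh : ℕ → Used → ℕ → (Used → List ℕ → ℕ) → ℕ
  sumFresh m U zero    f = f U []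
  sumFresh m U (suc k) f = ∑[ a < m ] (if U a then 0 else sumFresh m (mark a U) k (λ U′ w → f U′ (a ∷ w)))

  #fresh : ℕ → Used → ℕ
  #fresh m U = ∑[ b < m ] (if U b then 0 else 1)

  if-∨ : ∀ b c (x : ℕ) → (if b ∨ c then 0 else x) ≡ (if b then 0 else (if c then 0 else x))
  if-∨ true  c x = refl
  if-∨ false c x = refl

  #fresh-mark : ∀ m U a → U a ≡ false → a < m → suc (#fresh m (mark a U)) ≡ #fresh m U
  #fresh-mark m U a Ua a<m = begin
    suc (#fresh m (mark a U))
      ≡⟨ cong suc (∑-cong m λ b _ → if-∨ (b ≡ᵇ a) (U b) 1) ⟩
    suc (∑[ b < m ] (if b ≡ᵇ a then 0 else (if U b then 0 else 1)))
      ≡⟨ cong (λ x → (if x then 0 else 1) + ∑[ b < m ] (if b ≡ᵇ a then 0 else (if U b then 0 else 1))) Ua ⟨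
    (if U a then 0 else 1) + ∑[ b < m ] (if b ≡ᵇ a then 0 else (if U b then 0 else 1))
      ≡⟨ ∑-extract m a (λ b → if U b then 0 else 1) a<m ⟨
    #fresh m U ∎
    where open ≡-Reasoning

  #fresh-nothingUsed : ∀ m → #fresh m nothingUsed ≡ m
  #fresh-nothingUsed zero    = refl
  #fresh-nothingUsed (suc m) = trans (cong (_+ 1) (#fresh-nothingUsed m)) (+-comm m 1)

  FreshWord-unmark : ∀ m U a w → FreshWord m (mark a U) w → FreshWord m U w
  FreshWord-unmark m U a []      []               = []
  FreshWord-unmark m U a (b ∷ w) ((e , l) ∷ fresh) = (∨-conicalʳ (b ≡ᵇ a) (U b) e , l) ∷ FreshWord-unmark m U a w fresh

  ⊆ᵘ-unmark : ∀ U a V → mark a U ⊆ᵘ V → U ⊆ᵘ V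
  ⊆ᵘ-unmark U a V s b e = s b (trans (cong ((b ≡ᵇ a) ∨_) e) (∨-zeroʳ (b ≡ᵇ a)))

  sumFresh-cong : ∀ m k U (f g : Used → List ℕ → ℕ) →
    (∀ U′ w → U ⊆ᵘ U′ → #fresh m U′ + length w ≡ #fresh m U → length w ≡ k → FreshWord m U w → f U′ w ≡ g U′ w) →
    sumFresh m U k f ≡ sumFresh m U k g
  sumFresh-cong m zero    U f g f≡g = f≡g U [] (λ b e → e) (+-identityʳ _) refl []
  sumFresh-cong m (suc k) U f g f≡g = ∑-cong m step
    where
    step : ∀ a → a < m → (if U a then 0 else sumFresh m (mark a U) k (λ U′ w → f U′ (a ∷ w)))
                       ≡ (if U a then 0 else sumFresh m (mark a U) k (λ U′ w → g U′ (a ∷ w)))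
    step a a<m with U a in Ua
    ... | true  = refl
    ... | false = sumFresh-cong m k (mark a U) _ _ λ U′ w s #U′ len fresh →
      f≡g U′ (a ∷ w) (⊆ᵘ-unmark U a U′ s) (trans (+-suc _ _) (trans (cong suc #U′) (#fresh-mark m U a Ua a<m)))
          (cong suc len) ((Ua , a<m) ∷ FreshWord-unmark m U a w fresh)

  sumFresh-tooLong : ∀ m k U f → #fresh m U < k → sumFresh m U k f ≡ 0
  sumFresh-tooLong m (suc k) U f #U<k = ∑-zero m step
    where
    step : ∀ a → a < m → (if U a then 0 else sumFresh m (mark a U) k (λ U′ w → f U′ (a ∷ w))) ≡ 0
    step a a<m with U a in Ua
    ... | true  = refl
    ... | false = sumFresh-tooLong m k (mark a U) _ (≤-pred (subst (_< suc k) (sym (#fresh-mark m U a Ua a<m)) #U<k))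

  sumFresh-*ˡ : ∀ m k U c f → sumFresh m U k (λ U′ w → c * f U′ w) ≡ c * sumFresh m U k f
  sumFresh-*ˡ m zero    U c f = refl
  sumFresh-*ˡ m (suc k) U c f = trans (∑-cong m λ a _ → step a) (∑-distribˡ m c _)
    where
    step : ∀ a → (if U a then 0 else sumFresh m (mark a U) k (λ U′ w → c * f U′ (a ∷ w)))
               ≡ c * (if U a then 0 else sumFresh m (mark a U) k (λ U′ w → f U′ (a ∷ w)))
    step a with U a
    ... | true  = sym (*-zeroʳ c)
    ... | false = sumFresh-*ˡ m k (mark a U) c _

  sumFresh-zero : ∀ m k U → sumFresh m U k (λ _ _ → 0) ≡ 0
  sumFresh-zero m k U = sumFresh-*ˡ m k U 0 (λ _ _ → 0)

  RespectsUsed : (Used → List ℕ → ℕ) → Set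
  RespectsUsed f = ∀ U V w → (∀ b → U b ≡ V b) → f U w ≡ f V w

  sumFresh-respects : ∀ m k U V f → RespectsUsed f → (∀ b → U b ≡ V b) → sumFresh m U k f ≡ sumFresh m V k f
  sumFresh-respects m zero    U V f resp U≗V = resp U V [] U≗V
  sumFresh-respects m (suc k) U V f resp U≗V = ∑-cong m λ a _ →
    cong₂ (λ c x → if c then 0 else x) (U≗V a)
          (sumFresh-respects m k (mark a U) (mark a V) _ (λ U′ V′ w → resp U′ V′ (a ∷ w)) (λ b → cong ((b ≡ᵇ a) ∨_) (U≗V b)))

  mark-comm : ∀ M a U b → mark M (mark a U) b ≡ mark a (mark M U) b
  mark-comm M a U b = trans (sym (∨-assoc (b ≡ᵇ M) (b ≡ᵇ a) (U b)))
    (trans (cong (_∨ U b) (∨-comm (b ≡ᵇ M) (b ≡ᵇ a))) (∨-assoc (b ≡ᵇ a) (b ≡ᵇ M) (U b)))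

  if-false-cong : ∀ c {x y : ℕ} → (c ≡ false → x ≡ y) → (if c then 0 else x) ≡ (if c then 0 else y)
  if-false-cong true  _   = refl
  if-false-cong false x≡y = x≡y refl

  if-distrib : ∀ c k x (y : ℕ → ℕ) → (if c then 0 else x + ∑< k y) ≡ (if c then 0 else x) + ∑[ l < k ] (if c then 0 else y l)
  if-distrib true  k x y = sym (∑-zero k λ _ _ → refl)
  if-distrib false k x y = refl

  -- A word either avoids the letter M or has it at some position l.
  sumFresh-split : ∀ m k U M (f : List ℕ → ℕ) → U M ≡ false → M < m →
    sumFresh m U k (λ _ w → f w) ≡ sumFresh m (mark M U) k (λ _ w → f w)
      + ∑[ l < k ] sumFresh m (mark M U) l (λ U′ u → sumFresh m U′ (k ∸ suc l) (λ _ v → f (u ++ M ∷ v)))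
  sumFresh-split m zero    U M f UM M<m = sym (+-identityʳ _)
  sumFresh-split m (suc k) U M f UM M<m = begin
    ∑< m T                                                    ≡⟨ ∑-extract m M T M<m ⟩
    T M + ∑[ a < m ] (if a ≡ᵇ M then 0 else T a)              ≡⟨ cong₂ _+_ TM≡H0 (∑-cong m λ a _ → away a) ⟩
    H 0 + ∑[ a < m ] (if mark M U a then 0 else A a + ∑< k (B a))
      ≡⟨ cong (H 0 +_) (∑-cong m λ a _ → if-distrib (mark M U a) k (A a) (B a)) ⟩
    H 0 + ∑[ a < m ] ((if mark M U a then 0 else A a) + ∑[ l < k ] (if mark M U a then 0 else B a l))
      ≡⟨ cong (H 0 +_) (trans (∑-distrib-+ m _ _) (cong (sumFresh m (mark M U) (suc k) (λ _ w → f w) +_) (∑-comm m k _))) ⟩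
    H 0 + (sumFresh m (mark M U) (suc k) (λ _ w → f w) + ∑[ l < k ] H (suc l))
      ≡⟨ x∙yz≈y∙xz (H 0) (sumFresh m (mark M U) (suc k) (λ _ w → f w)) (∑[ l < k ] H (suc l)) ⟩
    sumFresh m (mark M U) (suc k) (λ _ w → f w) + (H 0 + ∑[ l < k ] H (suc l))
      ≡⟨ cong (sumFresh m (mark M U) (suc k) (λ _ w → f w) +_) (∑-head k H) ⟨
    sumFresh m (mark M U) (suc k) (λ _ w → f w) + ∑< (suc k) H ∎
    where
    open ≡-Reasoning
    open import Algebra.Properties.CommutativeSemigroup +-commutativeSemigroup using (x∙yz≈y∙xz)
    T : ℕ → ℕ
    T a = if U a then 0 else sumFresh m (mark a U) k (λ _ w → f (a ∷ w))
    H : ℕ → ℕ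
    H l = sumFresh m (mark M U) l (λ U′ u → sumFresh m U′ (suc k ∸ suc l) (λ _ v → f (u ++ M ∷ v)))
    A : ℕ → ℕ
    A a = sumFresh m (mark a (mark M U)) k (λ _ w → f (a ∷ w))
    B : ℕ → ℕ → ℕ
    B a l = sumFresh m (mark a (mark M U)) l (λ U′ u → sumFresh m U′ (k ∸ suc l) (λ _ v → f (a ∷ u ++ M ∷ v)))
    TM≡H0 : T M ≡ H 0
    TM≡H0 = cong (λ c → if c then 0 else H 0) UM
    unmarked : ∀ a → mark M U a ≡ false → sumFresh m (mark a U) k (λ _ w → f (a ∷ w)) ≡ A a + ∑< k (B a)
    unmarked a MUa = trans (sumFresh-split m k (mark a U) M (λ w → f (a ∷ w)) aUM M<m)
      (cong₂ _+_ (sumFresh-respects m k _ _ _ (λ _ _ _ _ → refl) swap)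
                 (∑-cong k λ l _ → sumFresh-respects m l _ _ _
                    (λ U′ V′ u U′≗V′ → sumFresh-respects m (k ∸ suc l) U′ V′ _ (λ _ _ _ _ → refl) U′≗V′) swap))
      where
      swap : ∀ b → mark M (mark a U) b ≡ mark a (mark M U) b
      swap = mark-comm M a U
      aUM : mark a U M ≡ false
      aUM = trans (cong (_∨ U M) (trans (≡ᵇ-sym M a) (∨-conicalˡ (a ≡ᵇ M) (U a) MUa))) UM
    away : ∀ a → (if a ≡ᵇ M then 0 else T a) ≡ (if mark M U a then 0 else A a + ∑< k (B a))
    away a = trans (sym (if-∨ (a ≡ᵇ M) (U a) _)) (if-false-cong (mark M U a) (unmarked a))

  boolToℕ : Bool → ℕ
  boolToℕ true  = 1
  boolToℕ false = 0

  avoids : Used → List ℕ → Bool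
  avoids U []       = true
  avoids U (x ∷ xs) = not (U x) ∧ avoids U xs

  #filter : (List ℕ → Bool) → List (List ℕ) → ℕ
  #filter Q ws = length (filterᵇ Q ws)

  #filter-++ : ∀ Q ws vs → #filter Q (ws ++ vs) ≡ #filter Q ws + #filter Q vs
  #filter-++ Q []       vs = refl
  #filter-++ Q (w ∷ ws) vs with Q w
  ... | true  = cong suc (#filter-++ Q ws vs)
  ... | false = #filter-++ Q ws vs

  #filter-concatMap-upTo : ∀ Q (g : ℕ → List (List ℕ)) m → #filter Q (concatMap g (upTo m)) ≡ ∑[ a < m ] #filter Q (g a)
  #filter-concatMap-upTo Q g zero    = refl
  #filter-concatMap-upTo Q g (suc m) = begin
    #filter Q (concatMap g (upTo (suc m)))               ≡⟨ cong (#filter Q ∘ concatMap g) (upTo-∷ʳ m) ⟨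
    #filter Q (concatMap g (upTo m ++ m ∷ []))            ≡⟨ cong (#filter Q) (concatMap-++ g (upTo m) (m ∷ [])) ⟩
    #filter Q (concatMap g (upTo m) ++ (g m ++ []))       ≡⟨ #filter-++ Q (concatMap g (upTo m)) (g m ++ []) ⟩
    #filter Q (concatMap g (upTo m)) + #filter Q (g m ++ []) ≡⟨ cong₂ _+_ (#filter-concatMap-upTo Q g m) (cong (#filter Q) (++-identityʳ (g m))) ⟩
    ∑[ a < suc m ] #filter Q (g a) ∎
    where open ≡-Reasoning

  #filter-map-∷ : ∀ Q a ws → #filter Q (map (a ∷_) ws) ≡ #filter (λ w → Q (a ∷ w)) ws
  #filter-map-∷ Q a []       = refl
  #filter-map-∷ Q a (w ∷ ws) with Q (a ∷ w)
  ... | true  = cong suc (#filter-map-∷ Q a ws)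
  ... | false = #filter-map-∷ Q a ws

  #filter-cong : ∀ Q Q′ ws → (∀ w → Q w ≡ Q′ w) → #filter Q ws ≡ #filter Q′ ws
  #filter-cong Q Q′ []       Q≗Q′ = refl
  #filter-cong Q Q′ (w ∷ ws) Q≗Q′ with Q w | Q′ w | Q≗Q′ w
  ... | true  | true  | _ = cong suc (#filter-cong Q Q′ ws Q≗Q′)
  ... | false | false | _ = #filter-cong Q Q′ ws Q≗Q′

  #filter-filter : ∀ D Q ws → #filter Q (filterᵇ D ws) ≡ #filter (λ w → D w ∧ Q w) ws
  #filter-filter D Q [] = refl
  #filter-filter D Q (w ∷ ws) with D w
  ... | false = #filter-filter D Q ws
  ... | true with Q w
  ...   | true  = cong suc (#filter-filter D Q ws)
  ...   | false = #filter-filter D Q ws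

  #filter-false : ∀ ws → #filter (λ _ → false) ws ≡ 0
  #filter-false []       = refl
  #filter-false (w ∷ ws) = #filter-false ws

  #filter-if : ∀ b Q ws → #filter (λ w → if b then false else Q w) ws ≡ (if b then 0 else #filter Q ws)
  #filter-if true  Q ws = #filter-false ws
  #filter-if false Q ws = refl

  avoids-mark : ∀ a U w → avoids (mark a U) w ≡ not (any (a ≡ᵇ_) w) ∧ avoids U w
  avoids-mark a U []      = refl
  avoids-mark a U (x ∷ w) rewrite ≡ᵇ-sym x a | avoids-mark a U w with a ≡ᵇ x | U x
  ... | true  | _     = refl
  ... | false | true  = sym (∧-zeroʳ (not (any (a ≡ᵇ_) w)))
  ... | false | false = refl

  admissible-∷ : ∀ U a w (P : List ℕ → Bool) →
    (distinct (a ∷ w) ∧ (avoids U (a ∷ w) ∧ P (a ∷ w))) ≡ (if U a then false else (distinct w ∧ (avoids (mark a U) w ∧ P (a ∷ w))))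
  admissible-∷ U a w P rewrite avoids-mark a U w with U a | any (a ≡ᵇ_) w
  ... | true  | true  = refl
  ... | true  | false = ∧-zeroʳ (distinct w)
  ... | false | true  = sym (∧-zeroʳ (distinct w))
  ... | false | false = refl

  #filter-words : ∀ m k U (P : List ℕ → Bool) →
    #filter (λ w → distinct w ∧ (avoids U w ∧ P w)) (words m k) ≡ sumFresh m U k (λ _ w → boolToℕ (P w))
  #filter-words m zero    U P with P []
  ... | true  = refl
  ... | false = refl
  #filter-words m (suc k) U P = trans (#filter-concatMap-upTo _ _ m) (∑-cong m λ a _ → first a)
    where
    first : ∀ a → #filter (λ w → distinct w ∧ (avoids U w ∧ P w)) (map (a ∷_) (words m k))
                ≡ (if U a then 0 else sumFresh m (mark a U) k (λ _ w → boolToℕ (P (a ∷ w))))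
    first a = trans (#filter-map-∷ _ a (words m k))
      (trans (#filter-cong _ _ (words m k) λ w → admissible-∷ U a w P)
      (trans (#filter-if (U a) _ (words m k))
             (cong (λ n → if U a then 0 else n) (#filter-words m k (mark a U) (λ w → P (a ∷ w))))))

  #filter-perms : ∀ m (P : List ℕ → Bool) → #filter P (perms m) ≡ sumFresh m nothingUsed m (λ _ w → boolToℕ (P w))
  #filter-perms m P = trans (#filter-filter distinct P (words m m))
    (trans (#filter-cong _ _ (words m m) λ w → cong (distinct w ∧_) (sym (cong (_∧ P w) (avoids-nothing w))))
           (#filter-words m m nothingUsed P))
    where
    avoids-nothing : ∀ w → avoids nothingUsed w ≡ true
    avoids-nothing []      = refl
    avoids-nothing (x ∷ w) = avoids-nothing w

  sumFresh-product : ∀ m k j U (F : List ℕ → List ℕ → ℕ) (g h : List ℕ → ℕ) K →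
    (∀ U′ u v → U ⊆ᵘ U′ → length u ≡ k → FreshWord m U u → FreshWord m U′ v → F u v ≡ g u * h v) →
    (∀ U′ → #fresh m U′ + k ≡ #fresh m U → sumFresh m U′ j (λ _ v → h v) ≡ K) →
    sumFresh m U k (λ U′ u → sumFresh m U′ j (λ _ v → F u v)) ≡ K * sumFresh m U k (λ _ u → g u)
  sumFresh-product m k j U F g h K F≡gh ∑h≡K =
    trans (sumFresh-cong m k U _ _ outer) (sumFresh-*ˡ m k U K (λ _ u → g u))
    where
    outer : ∀ U′ u → U ⊆ᵘ U′ → #fresh m U′ + length u ≡ #fresh m U → length u ≡ k → FreshWord m U u →
            sumFresh m U′ j (λ _ v → F u v) ≡ K * g u
    outer U′ u U⊆U′ #U′ len fresh-u = begin
      sumFresh m U′ j (λ _ v → F u v)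
        ≡⟨ sumFresh-cong m j U′ _ _ (λ _ v _ _ _ fresh-v → F≡gh U′ u v U⊆U′ len fresh-u fresh-v) ⟩
      sumFresh m U′ j (λ _ v → g u * h v)  ≡⟨ sumFresh-*ˡ m j U′ (g u) (λ _ v → h v) ⟩
      g u * sumFresh m U′ j (λ _ v → h v)  ≡⟨ cong (g u *_) (∑h≡K U′ (subst (λ n → #fresh m U′ + n ≡ #fresh m U) len #U′)) ⟩
      g u * K                               ≡⟨ *-comm (g u) K ⟩
      K * g u                               ∎
      where open ≡-Reasoning

module AroundMaximum where

  open import Data.Bool using (Bool; true; false; _∧_; _∨_; not; if_then_else_)
  open import Data.Bool.Properties using (∨-zeroʳ; ∨-conicalˡ; ∨-conicalʳ)
  open import Data.Bool.ListAction using (any)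
  open import Data.List using (List; []; _∷_; length; _++_)
  open import Data.List.Relation.Unary.All using (All; []; _∷_)
  open import Data.Nat
  open import Data.Nat.Properties
  open import Data.Product using (Σ-syntax; _×_; _,_)
  open import Data.Sum using (inj₁; inj₂)
  open import Relation.Binary.PropositionalEquality
  open import Defs using (ascAt; descAt; mmp1000)
  open NatBool
  open FreshWords

  AboveFresh : ℕ → Used → ℕ → Set
  AboveFresh m U M = ∀ b → b < m → U b ≡ false → b ≤ M

  largestFresh : ∀ m U N → #fresh m U ≡ suc N → Σ[ M ∈ ℕ ] U M ≡ false × M < m × AboveFresh m U M
  largestFresh (suc m) U N #U≡1+N with U m in Um
  ... | false = m , Um , ≤-refl , λ b b<1+m _ → ≤-pred b<1+m
  ... | true with largestFresh m U N (trans (sym (+-identityʳ _)) #U≡1+N)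
  ...   | M , UM , M<m , largest = M , UM , m<n⇒m<1+n M<m , largest′
    where
    largest′ : AboveFresh (suc m) U M
    largest′ b b<1+m Ub with m≤n⇒m<n∨m≡n (≤-pred b<1+m)
    ... | inj₁ b<m  = largest b b<m Ub
    ... | inj₂ refl with () ← trans (sym Um) Ub

  isEven : ℕ → Bool
  isEven zero    = true
  isEven (suc n) = not (isEven n)

  AllBelow : ℕ → List ℕ → Set
  AllBelow M = All (_< M)

  FreshWord⇒AllBelow : ∀ m U M → AboveFresh m U M →
    ∀ U′ w → mark M U ⊆ᵘ U′ → FreshWord m U′ w → AllBelow M w
  FreshWord⇒AllBelow m U M largest U′ []      s []                    = []
  FreshWord⇒AllBelow m U M largest U′ (b ∷ w) s ((U′b , b<m) ∷ fresh) =
    ≤∧≢⇒< (largest b b<m (∨-conicalʳ (b ≡ᵇ M) (U b) unmarked)) b≢M ∷ FreshWord⇒AllBelow m U M largest U′ w s fresh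
    where
    unmarked : mark M U b ≡ false
    unmarked with mark M U b in e
    ... | false = refl
    ... | true with () ← trans (sym (s b e)) U′b
    b≢M : b ≢ M
    b≢M refl with () ← trans (sym (≡ᵇ-refl b)) (∨-conicalˡ (b ≡ᵇ b) (U b) unmarked)

  descAt-max∷ : ∀ M v → AllBelow M v → descAt (M ∷ v) ≡ ascAt v
  descAt-max∷ M []      _           = refl
  descAt-max∷ M (y ∷ v) (y<M ∷ _) = cong (_∧ ascAt (y ∷ v)) (<⇒<ᵇ-true y<M)

  ascAt-max∷ : ∀ M y v → AllBelow M (y ∷ v) → ascAt (M ∷ y ∷ v) ≡ false
  ascAt-max∷ M y v (y<M ∷ _) = cong (_∧ descAt (y ∷ v)) (≥⇒<ᵇ-false (<⇒≤ y<M))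

  mutual
    ascAt-around-max : ∀ M x u v → AllBelow M (x ∷ u) → AllBelow M v →
      ascAt (x ∷ u ++ M ∷ v) ≡ ((ascAt (x ∷ u) ∧ isEven (length u)) ∧ ascAt v)
    ascAt-around-max M x []      v (x<M ∷ _)  v<M = trans (cong (_∧ descAt (M ∷ v)) (<⇒<ᵇ-true x<M)) (descAt-max∷ M v v<M)
    ascAt-around-max M x (y ∷ u) v (_ ∷ yu<M) v<M =
      trans (cong ((x <ᵇ y) ∧_) (descAt-around-max M y u v yu<M v<M)) (regroup (x <ᵇ y) (descAt (y ∷ u)) (isEven (length u)) (ascAt v))
      where
      regroup : ∀ a b c d → (a ∧ ((b ∧ not c) ∧ d)) ≡ (((a ∧ b) ∧ not c) ∧ d)
      regroup true  b c d = refl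
      regroup false b c d = refl

    descAt-around-max : ∀ M x u v → AllBelow M (x ∷ u) → AllBelow M v →
      descAt (x ∷ u ++ M ∷ v) ≡ ((descAt (x ∷ u) ∧ not (isEven (length u))) ∧ ascAt v)
    descAt-around-max M x []      v (x<M ∷ _)  v<M = cong (_∧ ascAt (M ∷ v)) (≥⇒<ᵇ-false (<⇒≤ x<M))
    descAt-around-max M x (y ∷ u) v (_ ∷ yu<M) v<M =
      trans (cong ((y <ᵇ x) ∧_) (ascAt-around-max M y u v yu<M v<M)) (regroup (y <ᵇ x) (ascAt (y ∷ u)) (isEven (length u)) (ascAt v))
      where
      regroup : ∀ a b c d → (a ∧ ((b ∧ c) ∧ d)) ≡ (((a ∧ b) ∧ not (not c)) ∧ d)
      regroup true  b true  d = refl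
      regroup true  b false d = refl
      regroup false b c     d = refl

  any-<ᵇ-around : ∀ M x u v → x < M → any (x <ᵇ_) (u ++ M ∷ v) ≡ true
  any-<ᵇ-around M x []      v x<M = cong (_∨ any (x <ᵇ_) v) (<⇒<ᵇ-true x<M)
  any-<ᵇ-around M x (y ∷ u) v x<M = trans (cong ((x <ᵇ y) ∨_) (any-<ᵇ-around M x u v x<M)) (∨-zeroʳ (x <ᵇ y))

  any-<ᵇ-below : ∀ M v → AllBelow M v → any (M <ᵇ_) v ≡ false
  any-<ᵇ-below M []      _           = refl
  any-<ᵇ-below M (y ∷ v) (y<M ∷ v<M) = trans (cong (_∨ any (M <ᵇ_) v) (≥⇒<ᵇ-false (<⇒≤ y<M))) (any-<ᵇ-below M v v<M)

  mmp1000-around-max : ∀ M u v → AllBelow M u → AllBelow M v → mmp1000 (u ++ M ∷ v) ≡ length u + mmp1000 v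
  mmp1000-around-max M []      v _           v<M = cong (λ b → (if b then 1 else 0) + mmp1000 v) (any-<ᵇ-below M v v<M)
  mmp1000-around-max M (x ∷ u) v (x<M ∷ u<M) v<M =
    cong₂ _+_ (cong (λ b → if b then 1 else 0) (any-<ᵇ-around M x u v x<M)) (mmp1000-around-max M u v u<M v<M)

module UpDown where

  open import Data.Bool using (true; false; _∧_)
  open import Data.List using (List; _∷_; length; _++_)
  open import Data.Nat
  open import Data.Nat.Combinatorics using (_C_; k>n⇒nCk≡0; nCn≡1; nCk+nC[k+1]≡[n+1]C[k+1])
  open import Data.Nat.Induction using (<-rec)
  open import Data.Nat.Properties
  open import Data.Nat.Solver using (module +-*-Solver)
  open import Data.Product using (_,_)
  open import Relation.Binary.PropositionalEquality
  open import Relation.Nullary using (yes; no)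
  open import Defs using (ascAt)
  open Binomial
  open RangeSum +-*-commutativeSemiring
  open FreshWords
  open AroundMaximum
  open +-*-Solver

  upDown : List ℕ → ℕ
  upDown w = boolToℕ (ascAt w)

  euler : ℕ → ℕ
  euler l = sumFresh l nothingUsed l (λ _ w → upDown w)

  boolToℕ-∧ : ∀ a b → boolToℕ (a ∧ b) ≡ boolToℕ a * boolToℕ b
  boolToℕ-∧ true  b = sym (+-identityʳ (boolToℕ b))
  boolToℕ-∧ false b = refl

  upDown-around-max : ∀ M x u v → AllBelow M (x ∷ u) → AllBelow M v →
    upDown (x ∷ u ++ M ∷ v) ≡ boolToℕ (isEven (length u)) * upDown (x ∷ u) * upDown v
  upDown-around-max M x u v xu<M v<M = begin
    upDown (x ∷ u ++ M ∷ v)                                   ≡⟨ cong boolToℕ (ascAt-around-max M x u v xu<M v<M) ⟩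
    boolToℕ ((ascAt (x ∷ u) ∧ isEven (length u)) ∧ ascAt v)  ≡⟨ boolToℕ-∧ _ (ascAt v) ⟩
    boolToℕ (ascAt (x ∷ u) ∧ isEven (length u)) * upDown v    ≡⟨ cong (_* upDown v) (boolToℕ-∧ (ascAt (x ∷ u)) _) ⟩
    upDown (x ∷ u) * boolToℕ (isEven (length u)) * upDown v   ≡⟨ cong (_* upDown v) (*-comm (upDown (x ∷ u)) _) ⟩
    boolToℕ (isEven (length u)) * upDown (x ∷ u) * upDown v   ∎
    where open ≡-Reasoning

  CountsUpDown : ℕ → Set
  CountsUpDown N = ∀ m U l → #fresh m U ≡ N → sumFresh m U l (λ _ w → upDown w) ≡ (N C l) * euler l

  maxTerm : ℕ → ℕ → ℕ → ℕ
  maxTerm N l i = boolToℕ (isEven i) * (((N ∸ suc i) C (l ∸ suc i)) * euler (l ∸ suc i)) * ((N C suc i) * euler (suc i))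

  upDown-maxFirst : ∀ {m U M} → AboveFresh m U M → ∀ l →
    sumFresh m (mark M U) 0 (λ U′ u → sumFresh m U′ (l ∸ 0) (λ _ v → upDown (u ++ M ∷ v))) ≡ boolToℕ (l ≡ᵇ 0)
  upDown-maxFirst                 largest zero    = refl
  upDown-maxFirst {m} {U} {M} largest (suc l) =
    trans (sumFresh-cong m (suc l) (mark M U) _ _ descentAfterMax) (sumFresh-zero m (suc l) (mark M U))
    where
    descentAfterMax : ∀ U′ v → mark M U ⊆ᵘ U′ → _ → length v ≡ suc l → FreshWord m (mark M U) v → upDown (M ∷ v) ≡ 0
    descentAfterMax U′ (y ∷ v) _ _ _ fresh = cong boolToℕ (ascAt-max∷ M y v (FreshWord⇒AllBelow m U M largest _ (y ∷ v) (λ _ e → e) fresh))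

  module _ {m U M N} (largest : AboveFresh m U M)
           (#MU : #fresh m (mark M U) ≡ N) (ih : ∀ N′ → N′ ≤ N → CountsUpDown N′) where

    upDown-maxAfter : ∀ l i →
      sumFresh m (mark M U) (suc i) (λ U′ u → sumFresh m U′ (l ∸ suc i) (λ _ v → upDown (u ++ M ∷ v))) ≡ maxTerm N l i
    upDown-maxAfter l i = begin
      sumFresh m (mark M U) (suc i) (λ U′ u → sumFresh m U′ (l ∸ suc i) (λ _ v → upDown (u ++ M ∷ v)))
        ≡⟨ sumFresh-product m (suc i) (l ∸ suc i) (mark M U) _ (λ u → boolToℕ (isEven i) * upDown u) upDown K factor rest ⟩
      K * sumFresh m (mark M U) (suc i) (λ _ u → boolToℕ (isEven i) * upDown u)
        ≡⟨ cong (K *_) (sumFresh-*ˡ m (suc i) (mark M U) (boolToℕ (isEven i)) (λ _ u → upDown u)) ⟩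
      K * (boolToℕ (isEven i) * sumFresh m (mark M U) (suc i) (λ _ u → upDown u))
        ≡⟨ cong (λ s → K * (boolToℕ (isEven i) * s)) (ih N ≤-refl m (mark M U) (suc i) #MU) ⟩
      K * (boolToℕ (isEven i) * ((N C suc i) * euler (suc i)))
        ≡⟨ solve 3 (λ k e c → k :* (e :* c) := e :* k :* c) refl K (boolToℕ (isEven i)) ((N C suc i) * euler (suc i)) ⟩
      maxTerm N l i ∎
      where
      open ≡-Reasoning
      K : ℕ
      K = ((N ∸ suc i) C (l ∸ suc i)) * euler (l ∸ suc i)
      factor : ∀ U′ u v → mark M U ⊆ᵘ U′ → length u ≡ suc i → FreshWord m (mark M U) u → FreshWord m U′ v →
               upDown (u ++ M ∷ v) ≡ boolToℕ (isEven i) * upDown u * upDown v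
      factor U′ (x ∷ u) v MU⊆U′ refl fresh-u fresh-v =
        upDown-around-max M x u v (FreshWord⇒AllBelow m U M largest _ (x ∷ u) (λ _ e → e) fresh-u)
                               (FreshWord⇒AllBelow m U M largest U′ v MU⊆U′ fresh-v)
      rest : ∀ U′ → #fresh m U′ + suc i ≡ #fresh m (mark M U) → sumFresh m U′ (l ∸ suc i) (λ _ v → upDown v) ≡ K
      rest U′ #U′ = ih (N ∸ suc i) (m∸n≤m N (suc i)) m U′ (l ∸ suc i)
                       (trans (sym (m+n∸n≡m _ (suc i))) (cong (_∸ suc i) (trans #U′ #MU)))

  maxSum : ℕ → ℕ → ℕ
  maxSum N l = boolToℕ (l ≡ᵇ 0) + ∑[ i < l ] maxTerm N l i

  upDown-step : ∀ m U N l → #fresh m U ≡ suc N → (∀ N′ → N′ ≤ N → CountsUpDown N′) →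
    sumFresh m U (suc l) (λ _ w → upDown w) ≡ (N C suc l) * euler (suc l) + maxSum N l
  upDown-step m U N l #U ih with largestFresh m U N #U
  ... | M , UM , M<m , largest = begin
    sumFresh m U (suc l) (λ _ w → upDown w)
      ≡⟨ sumFresh-split m (suc l) U M upDown UM M<m ⟩
    sumFresh m (mark M U) (suc l) (λ _ w → upDown w) + ∑< (suc l) H
      ≡⟨ cong₂ _+_ (ih N ≤-refl m (mark M U) (suc l) #MU) (∑-head l H) ⟩
    (N C suc l) * euler (suc l) + (H 0 + ∑[ i < l ] H (suc i))
      ≡⟨ cong (λ s → (N C suc l) * euler (suc l) + s)
              (cong₂ _+_ (upDown-maxFirst largest l) (∑-cong l λ i _ → upDown-maxAfter largest #MU ih l i)) ⟩
    (N C suc l) * euler (suc l) + maxSum N l ∎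
    where
    open ≡-Reasoning
    H : ℕ → ℕ
    H i = sumFresh m (mark M U) i (λ U′ u → sumFresh m U′ (suc l ∸ suc i) (λ _ v → upDown (u ++ M ∷ v)))
    #MU : #fresh m (mark M U) ≡ N
    #MU = suc-injective (trans (#fresh-mark m U M UM M<m) #U)

  maxSum-scale : ∀ N l → l ≤ N → maxSum N l ≡ (N C l) * maxSum l l
  maxSum-scale N l l≤N =
    trans (cong₂ _+_ (first l) (trans (∑-cong l λ i i<l → term i i<l) (∑-distribˡ l (N C l) (maxTerm l l))))
          (sym (*-distribˡ-+ (N C l) _ _))
    where
    first : ∀ l → boolToℕ (l ≡ᵇ 0) ≡ (N C l) * boolToℕ (l ≡ᵇ 0)
    first zero    = refl
    first (suc l) = sym (*-zeroʳ (N C suc l))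
    term : ∀ i → i < l → maxTerm N l i ≡ (N C l) * maxTerm l l i
    term i i<l = begin
      e * (((N ∸ suc i) C (l ∸ suc i)) * E₁) * ((N C suc i) * E₂)
        ≡⟨ solve 5 (λ e x a y b → e :* (x :* a) :* (y :* b) := e :* a :* b :* (y :* x)) refl
             e ((N ∸ suc i) C (l ∸ suc i)) E₁ (N C suc i) E₂ ⟩
      e * E₁ * E₂ * ((N C suc i) * ((N ∸ suc i) C (l ∸ suc i)))
        ≡⟨ cong (e * E₁ * E₂ *_) (nCj*[n∸j]C[l∸j]≡nCl*lCj N l (suc i) i<l l≤N) ⟩
      e * E₁ * E₂ * ((N C l) * (l C suc i))
        ≡⟨ trans (sym (*-identityʳ _)) (cong (e * E₁ * E₂ * ((N C l) * (l C suc i)) *_) (sym (nCn≡1 (l ∸ suc i)))) ⟩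
      e * E₁ * E₂ * ((N C l) * (l C suc i)) * ((l ∸ suc i) C (l ∸ suc i))
        ≡⟨ solve 6 (λ e a b z w o → e :* a :* b :* (z :* w) :* o := z :* (e :* (o :* a) :* (w :* b))) refl
             e E₁ E₂ (N C l) (l C suc i) ((l ∸ suc i) C (l ∸ suc i)) ⟩
      (N C l) * maxTerm l l i ∎
      where
      open ≡-Reasoning
      e E₁ E₂ : ℕ
      e = boolToℕ (isEven i)
      E₁ = euler (l ∸ suc i)
      E₂ = euler (suc i)

  euler-suc : ∀ l → (∀ N′ → N′ ≤ l → CountsUpDown N′) → euler (suc l) ≡ maxSum l l
  euler-suc l ih = trans (upDown-step (suc l) nothingUsed l l (#fresh-nothingUsed (suc l)) ih)
                         (cong (λ c → c * euler (suc l) + maxSum l l) (k>n⇒nCk≡0 (n<1+n l)))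

  countsUpDown : ∀ N → CountsUpDown N
  countsUpDown = <-rec CountsUpDown count
    where
    count : ∀ N → (∀ {N′} → N′ < N → CountsUpDown N′) → CountsUpDown N
    count N       rec m U zero    #U = sym (+-identityʳ 1)
    count zero    rec m U (suc l) #U = sumFresh-tooLong m (suc l) U (λ _ w → upDown w) (subst (_< suc l) (sym #U) z<s)
    count (suc N) rec m U (suc l) #U with suc l ≤? suc N
    ... | no  l>N       = trans (sumFresh-tooLong m (suc l) U (λ _ w → upDown w) (subst (_< suc l) (sym #U) (≰⇒> l>N)))
                                (sym (cong (_* euler (suc l)) (k>n⇒nCk≡0 (≰⇒> l>N))))
    ... | yes (s≤s l≤N) = begin
      sumFresh m U (suc l) (λ _ w → upDown w)                       ≡⟨ upDown-step m U N l #U ih ⟩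
      (N C suc l) * euler (suc l) + maxSum N l                   ≡⟨ cong ((N C suc l) * euler (suc l) +_) (maxSum-scale N l l≤N) ⟩
      (N C suc l) * euler (suc l) + (N C l) * maxSum l l         ≡⟨ cong (λ e → (N C suc l) * euler (suc l) + (N C l) * e) (euler-suc l λ N′ N′≤l → ih N′ (≤-trans N′≤l l≤N)) ⟨
      (N C suc l) * euler (suc l) + (N C l) * euler (suc l)      ≡⟨ +-comm ((N C suc l) * euler (suc l)) _ ⟩
      (N C l) * euler (suc l) + (N C suc l) * euler (suc l)      ≡⟨ *-distribʳ-+ (euler (suc l)) (N C l) (N C suc l) ⟨
      ((N C l) + (N C suc l)) * euler (suc l)                    ≡⟨ cong (_* euler (suc l)) (nCk+nC[k+1]≡[n+1]C[k+1] N l) ⟩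
      (suc N C suc l) * euler (suc l)                            ∎
      where
      open ≡-Reasoning
      ih : ∀ N′ → N′ ≤ N → CountsUpDown N′
      ih N′ N′≤N = rec (s≤s N′≤N)

module UpDownMmp where

  open import Data.Bool using (Bool; true; false; _∧_; if_then_else_)
  open import Data.Bool.Properties using (∧-assoc)
  open import Data.List using (List; _∷_; length; _++_)
  open import Data.Nat
  open import Data.Nat.Combinatorics using (_C_)
  open import Data.Nat.Induction using (<-rec)
  open import Data.Nat.Properties
  open import Data.Nat.Solver using (module +-*-Solver)
  open import Data.Product using (_,_)
  open import Relation.Binary.PropositionalEquality
  open import Defs using (ascAt; mmp1000; isUpDown; A=; B1)
  open NatBool
  open RangeSum +-*-commutativeSemiring
  open FreshWords
  open AroundMaximum
  open UpDown
  open +-*-Solver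

  upDownWithMmp : ℕ → List ℕ → ℕ
  upDownWithMmp c w = boolToℕ (ascAt w ∧ (mmp1000 w ≡ᵇ c))

  upDownMmp : ℕ → ℕ → ℕ
  upDownMmp L c = sumFresh L nothingUsed L (λ _ w → upDownWithMmp c w)

  A=≡upDownMmp : ∀ n c → A= n c ≡ upDownMmp (2 * n) c
  A=≡upDownMmp n c = #filter-perms (2 * n) (λ σ → isUpDown σ ∧ (mmp1000 σ ≡ᵇ c))

  B1≡euler : ∀ j → B1 j ≡ euler (suc (2 * j))
  B1≡euler j = #filter-perms (suc (2 * j)) isUpDown

  CountsUpDownMmp : ℕ → Set
  CountsUpDownMmp N = ∀ m U c → #fresh m U ≡ N → sumFresh m U N (λ _ w → upDownWithMmp c w) ≡ upDownMmp N c

  -- The guard makes the term vanish when c < i + 1, where c ∸ suc i would be a junk value.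
  mmpTerm : ℕ → ℕ → ℕ → ℕ
  mmpTerm N c i = boolToℕ (isEven i) * (if suc i ≤ᵇ c then upDownMmp (N ∸ suc i) (c ∸ suc i) else 0) * ((N C suc i) * euler (suc i))

  mmpSum : ℕ → ℕ → ℕ
  mmpSum N c = boolToℕ ((N ≡ᵇ 0) ∧ (0 ≡ᵇ c)) + ∑[ i < N ] mmpTerm N c i

  boolToℕ-∧-if : ∀ b a (p : Bool) → boolToℕ (a ∧ (if b then p else false)) ≡ (if b then boolToℕ (a ∧ p) else 0)
  boolToℕ-∧-if true  a     p = refl
  boolToℕ-∧-if false true  p = refl
  boolToℕ-∧-if false false p = refl

  sumFresh-if : ∀ m U k b f → sumFresh m U k (λ U′ w → if b then f U′ w else 0) ≡ (if b then sumFresh m U k f else 0)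
  sumFresh-if m U k true  f = refl
  sumFresh-if m U k false f = sumFresh-zero m k U

  upDownWithMmp-around-max : ∀ M x u v c → AllBelow M (x ∷ u) → AllBelow M v →
    upDownWithMmp c (x ∷ u ++ M ∷ v)
      ≡ boolToℕ (isEven (length u)) * upDown (x ∷ u) * (if suc (length u) ≤ᵇ c then upDownWithMmp (c ∸ suc (length u)) v else 0)
  upDownWithMmp-around-max M x u v c xu<M v<M = begin
    boolToℕ (ascAt (x ∷ u ++ M ∷ v) ∧ (mmp1000 (x ∷ u ++ M ∷ v) ≡ᵇ c))
      ≡⟨ cong₂ (λ p q → boolToℕ (p ∧ (q ≡ᵇ c))) (ascAt-around-max M x u v xu<M v<M) (mmp1000-around-max M (x ∷ u) v xu<M v<M) ⟩
    boolToℕ (((ascAt (x ∷ u) ∧ e) ∧ ascAt v) ∧ ((suc (length u) + mmp1000 v) ≡ᵇ c))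
      ≡⟨ cong boolToℕ (∧-assoc (ascAt (x ∷ u) ∧ e) (ascAt v) _) ⟩
    boolToℕ ((ascAt (x ∷ u) ∧ e) ∧ (ascAt v ∧ ((suc (length u) + mmp1000 v) ≡ᵇ c)))
      ≡⟨ boolToℕ-∧ (ascAt (x ∷ u) ∧ e) _ ⟩
    boolToℕ (ascAt (x ∷ u) ∧ e) * boolToℕ (ascAt v ∧ ((suc (length u) + mmp1000 v) ≡ᵇ c))
      ≡⟨ cong₂ _*_ (trans (boolToℕ-∧ (ascAt (x ∷ u)) e) (*-comm (upDown (x ∷ u)) _))
                   (trans (cong (λ b → boolToℕ (ascAt v ∧ b)) (+-≡ᵇ-shift (suc (length u)) (mmp1000 v) c))
                          (boolToℕ-∧-if (suc (length u) ≤ᵇ c) (ascAt v) _)) ⟩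
    boolToℕ e * upDown (x ∷ u) * (if suc (length u) ≤ᵇ c then upDownWithMmp (c ∸ suc (length u)) v else 0) ∎
    where
    open ≡-Reasoning
    e : Bool
    e = isEven (length u)

  mmp-maxFirst : ∀ {m U M} → AboveFresh m U M → ∀ N c →
    sumFresh m (mark M U) 0 (λ U′ u → sumFresh m U′ (N ∸ 0) (λ _ v → upDownWithMmp c (u ++ M ∷ v))) ≡ boolToℕ ((N ≡ᵇ 0) ∧ (0 ≡ᵇ c))
  mmp-maxFirst                 largest zero    c = refl
  mmp-maxFirst {m} {U} {M} largest (suc l) c =
    trans (sumFresh-cong m (suc l) (mark M U) _ _ descentAfterMax) (sumFresh-zero m (suc l) (mark M U))
    where
    descentAfterMax : ∀ U′ v → mark M U ⊆ᵘ U′ → _ → length v ≡ suc l → FreshWord m (mark M U) v → upDownWithMmp c (M ∷ v) ≡ 0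
    descentAfterMax U′ (y ∷ v) _ _ _ fresh =
      cong (λ b → boolToℕ (b ∧ (mmp1000 (M ∷ y ∷ v) ≡ᵇ c))) (ascAt-max∷ M y v (FreshWord⇒AllBelow m U M largest _ (y ∷ v) (λ _ e → e) fresh))

  module _ {m U M N} (largest : AboveFresh m U M)
           (#MU : #fresh m (mark M U) ≡ N) (ih : ∀ N′ → N′ ≤ N → CountsUpDownMmp N′) where

    mmp-maxAfter : ∀ c i →
      sumFresh m (mark M U) (suc i) (λ U′ u → sumFresh m U′ (N ∸ suc i) (λ _ v → upDownWithMmp c (u ++ M ∷ v))) ≡ mmpTerm N c i
    mmp-maxAfter c i = begin
      sumFresh m (mark M U) (suc i) (λ U′ u → sumFresh m U′ (N ∸ suc i) (λ _ v → upDownWithMmp c (u ++ M ∷ v)))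
        ≡⟨ sumFresh-product m (suc i) (N ∸ suc i) (mark M U) _ (λ u → boolToℕ (isEven i) * upDown u) _ K factor rest ⟩
      K * sumFresh m (mark M U) (suc i) (λ _ u → boolToℕ (isEven i) * upDown u)
        ≡⟨ cong (K *_) (sumFresh-*ˡ m (suc i) (mark M U) (boolToℕ (isEven i)) (λ _ u → upDown u)) ⟩
      K * (boolToℕ (isEven i) * sumFresh m (mark M U) (suc i) (λ _ u → upDown u))
        ≡⟨ cong (λ s → K * (boolToℕ (isEven i) * s)) (countsUpDown N m (mark M U) (suc i) #MU) ⟩
      K * (boolToℕ (isEven i) * ((N C suc i) * euler (suc i)))
        ≡⟨ solve 3 (λ k e c → k :* (e :* c) := e :* k :* c) refl K (boolToℕ (isEven i)) ((N C suc i) * euler (suc i)) ⟩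
      mmpTerm N c i ∎
      where
      open ≡-Reasoning
      K : ℕ
      K = if suc i ≤ᵇ c then upDownMmp (N ∸ suc i) (c ∸ suc i) else 0
      factor : ∀ U′ u v → mark M U ⊆ᵘ U′ → length u ≡ suc i → FreshWord m (mark M U) u → FreshWord m U′ v →
               upDownWithMmp c (u ++ M ∷ v) ≡ boolToℕ (isEven i) * upDown u * (if suc i ≤ᵇ c then upDownWithMmp (c ∸ suc i) v else 0)
      factor U′ (x ∷ u) v MU⊆U′ refl fresh-u fresh-v =
        upDownWithMmp-around-max M x u v c (FreshWord⇒AllBelow m U M largest _ (x ∷ u) (λ _ e → e) fresh-u)
                                        (FreshWord⇒AllBelow m U M largest U′ v MU⊆U′ fresh-v)
      rest : ∀ U′ → #fresh m U′ + suc i ≡ #fresh m (mark M U) →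
             sumFresh m U′ (N ∸ suc i) (λ _ v → if suc i ≤ᵇ c then upDownWithMmp (c ∸ suc i) v else 0) ≡ K
      rest U′ #U′ = trans (sumFresh-if m U′ (N ∸ suc i) (suc i ≤ᵇ c) (λ _ v → upDownWithMmp (c ∸ suc i) v))
        (cong (λ s → if suc i ≤ᵇ c then s else 0)
              (ih (N ∸ suc i) (m∸n≤m N (suc i)) m U′ (c ∸ suc i)
                  (trans (sym (m+n∸n≡m _ (suc i))) (cong (_∸ suc i) (trans #U′ #MU)))))

  mmp-step : ∀ m U N c → #fresh m U ≡ suc N → (∀ N′ → N′ ≤ N → CountsUpDownMmp N′) →
    sumFresh m U (suc N) (λ _ w → upDownWithMmp c w) ≡ mmpSum N c
  mmp-step m U N c #U ih with largestFresh m U N #U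
  ... | M , UM , M<m , largest = begin
    sumFresh m U (suc N) (λ _ w → upDownWithMmp c w)
      ≡⟨ sumFresh-split m (suc N) U M (upDownWithMmp c) UM M<m ⟩
    sumFresh m (mark M U) (suc N) (λ _ w → upDownWithMmp c w) + ∑< (suc N) H
      ≡⟨ cong₂ _+_ (sumFresh-tooLong m (suc N) (mark M U) (λ _ w → upDownWithMmp c w) (s≤s (≤-reflexive #MU))) (∑-head N H) ⟩
    H 0 + ∑[ i < N ] H (suc i)
      ≡⟨ cong₂ _+_ (mmp-maxFirst largest N c) (∑-cong N λ i _ → mmp-maxAfter largest #MU ih c i) ⟩
    mmpSum N c ∎
    where
    open ≡-Reasoning
    H : ℕ → ℕ
    H i = sumFresh m (mark M U) i (λ U′ u → sumFresh m U′ (suc N ∸ suc i) (λ _ v → upDownWithMmp c (u ++ M ∷ v)))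
    #MU : #fresh m (mark M U) ≡ N
    #MU = suc-injective (trans (#fresh-mark m U M UM M<m) #U)

  countsUpDownMmp : ∀ N → CountsUpDownMmp N
  countsUpDownMmp = <-rec CountsUpDownMmp count
    where
    count : ∀ N → (∀ {N′} → N′ < N → CountsUpDownMmp N′) → CountsUpDownMmp N
    count zero    rec m U c #U = refl
    count (suc N) rec m U c #U =
      trans (mmp-step m U N c #U ih) (sym (mmp-step (suc N) nothingUsed N c (#fresh-nothingUsed (suc N)) ih))
      where
      ih : ∀ N′ → N′ ≤ N → CountsUpDownMmp N′
      ih N′ N′≤N = rec (s≤s N′≤N)

  upDownMmp-suc : ∀ N c → upDownMmp (suc N) c ≡ mmpSum N c
  upDownMmp-suc N c = mmp-step (suc N) nothingUsed N c (#fresh-nothingUsed (suc N)) λ N′ _ → countsUpDownMmp N′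

module Diagonal where

  open import Data.Bool using (true; false; not; if_then_else_)
  open import Data.Bool.Properties using (∧-zeroʳ; not-involutive)
  open import Data.Nat
  open import Data.Nat.Combinatorics using (_C_; nCn≡1; nC1≡n)
  open import Data.Nat.Induction using (<-rec)
  open import Data.Nat.Properties
  open import Data.Nat.Solver using (module +-*-Solver)
  open import Relation.Binary.PropositionalEquality
  open NatBool
  open RangeSum +-*-commutativeSemiring
  open FreshWords using (boolToℕ)
  open AroundMaximum using (isEven)
  open UpDown using (euler)
  open UpDownMmp
  open +-*-Solver

  if≤ᵇ-*-zero : ∀ s c (X Y : ℕ) → (s ≤ c → X ≡ 0) → (if s ≤ᵇ c then X else 0) * Y ≡ 0
  if≤ᵇ-*-zero s c X Y X≡0 with s ≤ᵇ c in s≤ᵇc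
  ... | true  = cong (_* Y) (X≡0 (≤ᵇ-true⇒≤ s c s≤ᵇc))
  ... | false = refl

  mmpTerms-zero : ∀ N c → (∀ i → i < N → suc i ≤ c → upDownMmp (N ∸ suc i) (c ∸ suc i) ≡ 0) → ∑< N (mmpTerm N c) ≡ 0
  mmpTerms-zero N c vanish = ∑-zero N λ i i<N →
    trans (*-assoc (boolToℕ (isEven i)) _ _)
          (trans (cong (boolToℕ (isEven i) *_) (if≤ᵇ-*-zero (suc i) c _ _ (vanish i i<N))) (*-zeroʳ (boolToℕ (isEven i))))

  upDownMmp-tooLarge : ∀ L c → L ≤ c → 1 ≤ c → upDownMmp L c ≡ 0
  upDownMmp-tooLarge = <-rec (λ L → ∀ c → L ≤ c → 1 ≤ c → upDownMmp L c ≡ 0) vanish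
    where
    vanish : ∀ L → (∀ {L′} → L′ < L → ∀ c → L′ ≤ c → 1 ≤ c → upDownMmp L′ c ≡ 0) → ∀ c → L ≤ c → 1 ≤ c → upDownMmp L c ≡ 0
    vanish zero    rec (suc c) _   _   = refl
    vanish (suc N) rec (suc c) L≤c 1≤c =
      trans (upDownMmp-suc N (suc c)) (cong₂ _+_ (cong boolToℕ (∧-zeroʳ (N ≡ᵇ 0))) (mmpTerms-zero N (suc c) shorter))
      where
      shorter : ∀ i → i < N → suc i ≤ suc c → upDownMmp (N ∸ suc i) (suc c ∸ suc i) ≡ 0
      shorter i i<N _ = rec (≤-<-trans (m∸n≤m N (suc i)) ≤-refl) (c ∸ i) (∸-monoˡ-≤ (suc i) (≤-trans (n≤1+n N) L≤c))
        (subst (_≤ c ∸ i) (m+n∸n≡m 1 i) (∸-monoˡ-≤ i (≤-pred (≤-trans (s≤s i<N) L≤c))))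

  upDownMmp-tooSmall : ∀ L c → suc (c + c) < L → upDownMmp L c ≡ 0
  upDownMmp-tooSmall = <-rec (λ L → ∀ c → suc (c + c) < L → upDownMmp L c ≡ 0) vanish
    where
    vanish : ∀ L → (∀ {L′} → L′ < L → ∀ c → suc (c + c) < L′ → upDownMmp L′ c ≡ 0) → ∀ c → suc (c + c) < L → upDownMmp L c ≡ 0
    vanish (suc (suc N)) rec c (s≤s 2c+1<1+N) = trans (upDownMmp-suc (suc N) c) (mmpTerms-zero (suc N) c shorter)
      where
      shorter : ∀ i → i < suc N → suc i ≤ c → upDownMmp (suc N ∸ suc i) (c ∸ suc i) ≡ 0
      shorter i _ 1+i≤c = rec (s≤s (≤-trans (m∸n≤m N i) (n≤1+n N))) c′ (m+n≤o⇒m≤o∸n (suc (suc (c′ + c′))) fits)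
        where
        c′ : ℕ
        c′ = c ∸ suc i
        c≡1+i+c′ : c ≡ suc i + c′
        c≡1+i+c′ = sym (m+[n∸m]≡n 1+i≤c)
        total : suc (suc (c′ + c′)) + suc i + i ≡ suc (c + c)
        total = trans (solve 2 (λ x y → con 2 :+ (x :+ x) :+ (con 1 :+ y) :+ y := con 1 :+ ((con 1 :+ y :+ x) :+ (con 1 :+ y :+ x))) refl c′ i)
                      (cong (λ z → suc (z + z)) (sym c≡1+i+c′))
        fits : suc (suc (c′ + c′)) + suc i ≤ suc N
        fits = ≤-trans (m≤m+n _ i) (subst (_≤ suc N) (sym total) 2c+1<1+N)

  α : ℕ → ℕ → ℕ
  α k n = upDownMmp (2 * n) (n + k)

  2*suc : ∀ n → 2 * suc n ≡ suc (suc (2 * n))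
  2*suc n = solve 1 (λ n → con 2 :* (con 1 :+ n) := con 2 :+ con 2 :* n) refl n

  isEven-double : ∀ n → isEven (2 * n) ≡ true
  isEven-double zero    = refl
  isEven-double (suc n) = trans (cong isEven (2*suc n)) (trans (not-involutive (isEven (2 * n))) (isEven-double n))

  ∑-evens : ∀ n (F : ℕ → ℕ) → ∑[ i < suc (2 * n) ] (boolToℕ (isEven i) * F i) ≡ ∑[ t < suc n ] F (2 * t)
  ∑-evens zero    F = cong (0 +_) (+-identityʳ (F 0))
  ∑-evens (suc n) F = begin
    ∑< (suc (2 * suc n)) T                                          ≡⟨ cong (λ z → ∑< (suc z) T) (2*suc n) ⟩
    ∑< (suc (2 * n)) T + T (suc (2 * n)) + T (suc (suc (2 * n)))
      ≡⟨ cong₂ (λ a b → a + b + T (suc (suc (2 * n)))) (∑-evens n F) (cong (λ b → boolToℕ (not b) * F (suc (2 * n))) (isEven-double n)) ⟩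
    ∑[ t < suc n ] F (2 * t) + 0 + T (suc (suc (2 * n)))
      ≡⟨ cong₂ _+_ (+-identityʳ _) (trans (cong (λ b → boolToℕ b * F (suc (suc (2 * n)))) (trans (not-involutive _) (isEven-double n))) (+-identityʳ _)) ⟩
    ∑[ t < suc n ] F (2 * t) + F (suc (suc (2 * n)))                ≡⟨ cong (λ z → ∑[ t < suc n ] F (2 * t) + F z) (2*suc n) ⟨
    ∑[ t < suc (suc n) ] F (2 * t)                                  ∎
    where
    open ≡-Reasoning
    T : ℕ → ℕ
    T i = boolToℕ (isEven i) * F i

  evenTerm : ℕ → ℕ → ℕ → ℕ
  evenTerm k n t = (if suc (2 * t) ≤ᵇ (suc n + k) then upDownMmp (suc (2 * n) ∸ suc (2 * t)) (suc n + k ∸ suc (2 * t)) else 0)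
                 * ((suc (2 * n) C suc (2 * t)) * euler (suc (2 * t)))

  α-suc-evenTerms : ∀ k n → α k (suc n) ≡ ∑< (suc n) (evenTerm k n)
  α-suc-evenTerms k n = begin
    upDownMmp (2 * suc n) (suc n + k)                            ≡⟨ cong (λ z → upDownMmp z (suc n + k)) (2*suc n) ⟩
    upDownMmp (suc (suc (2 * n))) (suc n + k)                    ≡⟨ upDownMmp-suc (suc (2 * n)) (suc n + k) ⟩
    ∑< (suc (2 * n)) (mmpTerm (suc (2 * n)) (suc n + k))         ≡⟨ ∑-cong (suc (2 * n)) (λ i _ → *-assoc (boolToℕ (isEven i)) _ _) ⟩
    ∑[ i < suc (2 * n) ] (boolToℕ (isEven i) * F i)              ≡⟨ ∑-evens n F ⟩
    ∑< (suc n) (evenTerm k n)                                    ∎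
    where
    open ≡-Reasoning
    c : ℕ
    c = suc n + k
    F : ℕ → ℕ
    F i = (if suc i ≤ᵇ c then upDownMmp (suc (2 * n) ∸ suc i) (c ∸ suc i) else 0) * ((suc (2 * n) C suc i) * euler (suc i))

  evenTerm-first : ∀ k n → evenTerm k n 0 ≡ α k n * suc (2 * n)
  evenTerm-first k n = cong (α k n *_) (trans (*-identityʳ _) (nC1≡n (suc (2 * n))))

  evenTerm-middle : ∀ i p q → evenTerm (suc i + q) (suc i + p) (suc i)
                            ≡ α q p * ((suc (2 * (suc i + p)) C suc (2 * suc i)) * euler (suc (2 * suc i)))
  evenTerm-middle i p q = cong (_* ((suc (2 * n) C suc (2 * suc i)) * euler (suc (2 * suc i))))
    (trans (cong (λ b → if b then upDownMmp (suc (2 * n) ∸ suc (2 * suc i)) (c ∸ suc (2 * suc i)) else 0) guard)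
           (cong₂ upDownMmp length≡ mmp≡))
    where
    n c : ℕ
    n = suc i + p
    c = suc n + (suc i + q)
    c≡ : c ≡ suc (2 * suc i) + (p + q)
    c≡ = solve 3 (λ i p q → (con 1 :+ (con 1 :+ i :+ p)) :+ (con 1 :+ i :+ q) := con 1 :+ con 2 :* (con 1 :+ i) :+ (p :+ q)) refl i p q
    guard : (suc (2 * suc i) ≤ᵇ c) ≡ true
    guard = ≤⇒≤ᵇ-true (subst (suc (2 * suc i) ≤_) (sym c≡) (m≤m+n _ _))
    length≡ : suc (2 * n) ∸ suc (2 * suc i) ≡ 2 * p
    length≡ = trans (cong (_∸ (2 * suc i)) (*-distribˡ-+ 2 (suc i) p)) (m+n∸m≡n (2 * suc i) (2 * p))
    mmp≡ : c ∸ suc (2 * suc i) ≡ p + q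
    mmp≡ = trans (cong (_∸ suc (2 * suc i)) c≡) (m+n∸m≡n (suc (2 * suc i)) (p + q))

  evenTerm-beyond : ∀ k r d → evenTerm k (suc k + r + d) (suc k + r) ≡ 0
  evenTerm-beyond k r d = if≤ᵇ-*-zero (suc (2 * t)) c _ _ tooSmall
    where
    t n c : ℕ
    t = suc k + r
    n = t + d
    c = suc n + k
    tooSmall : suc (2 * t) ≤ c → upDownMmp (suc (2 * n) ∸ suc (2 * t)) (c ∸ suc (2 * t)) ≡ 0
    tooSmall 1+2t≤c = upDownMmp-tooSmall _ c′ (subst (suc (c′ + c′) <_) (sym length≡) (subst (λ z → suc (c′ + c′) < z + z) (sym d≡) 2c′+1<2d))
      where
      c′ P : ℕ
      c′ = c ∸ suc (2 * t)
      P = suc (suc (k + r + k))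
      d≡ : d ≡ suc r + c′
      d≡ = +-cancelˡ-≡ P d (suc r + c′)
        (trans (solve 3 (λ k r d → con 2 :+ (k :+ r :+ k) :+ d := con 1 :+ (con 1 :+ k :+ r :+ d) :+ k) refl k r d)
        (trans (sym (m+[n∸m]≡n 1+2t≤c))
               (solve 3 (λ k r c′ → con 1 :+ con 2 :* (con 1 :+ k :+ r) :+ c′ := con 2 :+ (k :+ r :+ k) :+ (con 1 :+ r :+ c′)) refl k r c′)))
      length≡ : suc (2 * n) ∸ suc (2 * t) ≡ d + d
      length≡ = trans (cong (_∸ (2 * t)) (solve 2 (λ t d → con 2 :* (t :+ d) := con 2 :* t :+ (d :+ d)) refl t d)) (m+n∸m≡n (2 * t) (d + d))
      2c′+1<2d : suc (c′ + c′) < (suc r + c′) + (suc r + c′)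
      2c′+1<2d = subst (suc (suc (c′ + c′)) ≤_) (solve 2 (λ r c′ → con 2 :+ (c′ :+ c′) :+ (r :+ r) := (con 1 :+ r :+ c′) :+ (con 1 :+ r :+ c′)) refl r c′)
                       (m≤m+n _ (r + r))

  α-suc : ∀ k n → k ≤ n →
    α k (suc n) ≡ α k n * suc (2 * n) + ∑[ i < k ] (α (k ∸ suc i) (n ∸ suc i) * ((suc (2 * n) C suc (2 * suc i)) * euler (suc (2 * suc i))))
  α-suc k n k≤n = begin
    α k (suc n)                                                      ≡⟨ α-suc-evenTerms k n ⟩
    ∑< (suc n) (evenTerm k n)                                        ≡⟨ cong (λ z → ∑< (suc z) (evenTerm k n)) (m+[n∸m]≡n k≤n) ⟨
    ∑< (suc k + (n ∸ k)) (evenTerm k n)                              ≡⟨ ∑-split (suc k) (n ∸ k) (evenTerm k n) ⟩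
    ∑< (suc k) (evenTerm k n) + ∑[ r < n ∸ k ] evenTerm k n (suc k + r)
      ≡⟨ cong₂ _+_ (∑-head k (evenTerm k n)) (∑-zero (n ∸ k) beyond) ⟩
    evenTerm k n 0 + ∑[ i < k ] evenTerm k n (suc i) + 0             ≡⟨ +-identityʳ _ ⟩
    evenTerm k n 0 + ∑[ i < k ] evenTerm k n (suc i)                 ≡⟨ cong₂ _+_ (evenTerm-first k n) (∑-cong k middle) ⟩
    α k n * suc (2 * n) + ∑[ i < k ] (α (k ∸ suc i) (n ∸ suc i) * ((suc (2 * n) C suc (2 * suc i)) * euler (suc (2 * suc i)))) ∎
    where
    open ≡-Reasoning
    beyond : ∀ r → r < n ∸ k → evenTerm k n (suc k + r) ≡ 0
    beyond r r<n∸k = subst (λ z → evenTerm k z (suc k + r) ≡ 0) (m+[n∸m]≡n 1+k+r≤n) (evenTerm-beyond k r (n ∸ (suc k + r)))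
      where
      1+k+r≤n : suc k + r ≤ n
      1+k+r≤n = subst (_≤ n) (+-suc k r) (subst (k + suc r ≤_) (m+[n∸m]≡n k≤n) (+-monoʳ-≤ k r<n∸k))
    middle : ∀ i → i < k → evenTerm k n (suc i) ≡ α (k ∸ suc i) (n ∸ suc i) * ((suc (2 * n) C suc (2 * suc i)) * euler (suc (2 * suc i)))
    middle i i<k = subst₂ Shape (m+[n∸m]≡n i<k) (m+[n∸m]≡n (≤-trans i<k k≤n))
      (subst₂ (λ a b → evenTerm (suc i + (k ∸ suc i)) (suc i + (n ∸ suc i)) (suc i)
                         ≡ α a b * ((suc (2 * (suc i + (n ∸ suc i))) C suc (2 * suc i)) * euler (suc (2 * suc i))))
              (sym (m+n∸m≡n (suc i) (k ∸ suc i))) (sym (m+n∸m≡n (suc i) (n ∸ suc i)))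
              (evenTerm-middle i (n ∸ suc i) (k ∸ suc i)))
      where
      Shape : ℕ → ℕ → Set
      Shape a b = evenTerm a b (suc i) ≡ α (a ∸ suc i) (b ∸ suc i) * ((suc (2 * b) C suc (2 * suc i)) * euler (suc (2 * suc i)))

  α-diagonal : ∀ m → 1 ≤ m → α m m ≡ 0
  α-diagonal m 1≤m = upDownMmp-tooLarge (2 * m) (m + m) (≤-reflexive (solve 1 (λ m → con 2 :* m := m :+ m) refl m)) (≤-trans 1≤m (m≤m+n m m))

  α-first : ∀ k → α k (suc k) ≡ euler (suc (2 * k))
  α-first zero     = refl
  α-first (suc k′) = begin
    α k (suc k)                                           ≡⟨ α-suc k k ≤-refl ⟩
    α k k * suc (2 * k) + ∑< (suc k′) H                   ≡⟨ cong (λ a → a * suc (2 * k) + ∑< (suc k′) H) (α-diagonal k (s≤s z≤n)) ⟩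
    ∑< k′ H + H k′                                        ≡⟨ cong (_+ H k′) (∑-zero k′ earlier) ⟩
    H k′                                                  ≡⟨ cong (λ z → α z z * ((suc (2 * k) C suc (2 * k)) * euler (suc (2 * k)))) (n∸n≡0 k′) ⟩
    1 * ((suc (2 * k) C suc (2 * k)) * euler (suc (2 * k))) ≡⟨ trans (*-identityˡ _) (trans (cong (_* euler (suc (2 * k))) (nCn≡1 (suc (2 * k)))) (*-identityˡ _)) ⟩
    euler (suc (2 * k))                                   ∎
    where
    open ≡-Reasoning
    k : ℕ
    k = suc k′
    H : ℕ → ℕ
    H i = α (k ∸ suc i) (k ∸ suc i) * ((suc (2 * k) C suc (2 * suc i)) * euler (suc (2 * suc i)))
    earlier : ∀ i → i < k′ → H i ≡ 0
    earlier i i<k′ = cong (_* ((suc (2 * k) C suc (2 * suc i)) * euler (suc (2 * suc i))))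
      (α-diagonal (k′ ∸ i) (subst (_≤ k′ ∸ i) (m+n∸n≡m 1 i) (∸-monoˡ-≤ i i<k′)))

module DoubleFactorial where

  open import Data.Nat
  open import Data.Nat.Combinatorics using (_C_)
  open import Data.Nat.Properties
  open import Data.Nat.Solver using (module +-*-Solver)
  open import Relation.Binary.PropositionalEquality
  open import Defs using (dfact; fall)
  open Binomial
  open +-*-Solver

  dfact*[2^m*m!]≡[2m]! : ∀ m → dfact m * (2 ^ m * m !) ≡ (2 * m) !
  dfact*[2^m*m!]≡[2m]! zero    = refl
  dfact*[2^m*m!]≡[2m]! (suc m) = begin
    suc (2 * m) * dfact m * (2 * 2 ^ m * (suc m * m !))
      ≡⟨ solve 4 (λ x d p f → (con 1 :+ con 2 :* x) :* d :* (con 2 :* p :* ((con 1 :+ x) :* f))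
                            := (con 2 :+ con 2 :* x) :* ((con 1 :+ con 2 :* x) :* (d :* (p :* f)))) refl m (dfact m) (2 ^ m) (m !) ⟩
    (2 + 2 * m) * ((1 + 2 * m) * (dfact m * (2 ^ m * m !))) ≡⟨ cong (λ z → (2 + 2 * m) * ((1 + 2 * m) * z)) (dfact*[2^m*m!]≡[2m]! m) ⟩
    (suc (suc (2 * m))) !                                 ≡⟨ cong _! (solve 1 (λ m → con 2 :* (con 1 :+ m) := con 2 :+ con 2 :* m) refl m) ⟨
    (2 * suc m) !                                         ∎
    where open ≡-Reasoning

  fall*[n∸j]!≡n! : ∀ n j → j ≤ n → fall n j * (n ∸ j) ! ≡ n !
  fall*[n∸j]!≡n! n zero    _   = +-identityʳ (n !)
  fall*[n∸j]!≡n! n (suc j) j<n = begin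
    fall n j * (n ∸ j) * (n ∸ suc j) !   ≡⟨ *-assoc (fall n j) _ _ ⟩
    fall n j * ((n ∸ j) * (n ∸ suc j) !) ≡⟨ cong (λ z → fall n j * (z * (n ∸ suc j) !)) n∸j≡1+n∸1+j ⟩
    fall n j * (suc (n ∸ suc j) !)       ≡⟨ cong (λ z → fall n j * z !) n∸j≡1+n∸1+j ⟨
    fall n j * (n ∸ j) !                 ≡⟨ fall*[n∸j]!≡n! n j (<⇒≤ j<n) ⟩
    n !                                  ∎
    where
    open ≡-Reasoning
    n∸j≡1+n∸1+j : n ∸ j ≡ suc (n ∸ suc j)
    n∸j≡1+n∸1+j = +-∸-assoc 1 j<n

  -- Both sides times 2^(n-j) (n-j)! equal (2n+1)!.
  oddChoose-dfact : ∀ n j → j ≤ n →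
    (suc (2 * n) C suc (2 * j)) * (suc (2 * j)) ! * dfact (n ∸ j) ≡ 2 ^ j * fall n j * dfact (suc n)
  oddChoose-dfact n j j≤n = *-cancelʳ-≡ _ _ (2 ^ d * d !) {{m*n≢0 (2 ^ d) (d !) {{m^n≢0 2 d}} {{d !≢0}}}} (trans viaChoose (sym viaFall))
    where
    open ≡-Reasoning
    d : ℕ
    d = n ∸ j
    2n+1∸2j+1≡2d : suc (2 * n) ∸ suc (2 * j) ≡ 2 * d
    2n+1∸2j+1≡2d = trans (cong (λ z → 2 * z ∸ 2 * j) (sym (m+[n∸m]≡n j≤n)))
                         (trans (cong (_∸ 2 * j) (*-distribˡ-+ 2 j d)) (m+n∸m≡n (2 * j) (2 * d)))
    viaChoose : (suc (2 * n) C suc (2 * j)) * (suc (2 * j)) ! * dfact d * (2 ^ d * d !) ≡ (suc (2 * n)) !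
    viaChoose = begin
      (suc (2 * n) C suc (2 * j)) * (suc (2 * j)) ! * dfact d * (2 ^ d * d !)
        ≡⟨ solve 5 (λ a b c x y → a :* b :* c :* (x :* y) := a :* (b :* (c :* (x :* y)))) refl
             (suc (2 * n) C suc (2 * j)) ((suc (2 * j)) !) (dfact d) (2 ^ d) (d !) ⟩
      (suc (2 * n) C suc (2 * j)) * ((suc (2 * j)) ! * (dfact d * (2 ^ d * d !)))
        ≡⟨ cong (λ z → (suc (2 * n) C suc (2 * j)) * ((suc (2 * j)) ! * z)) (trans (dfact*[2^m*m!]≡[2m]! d) (cong _! (sym 2n+1∸2j+1≡2d))) ⟩
      (suc (2 * n) C suc (2 * j)) * ((suc (2 * j)) ! * (suc (2 * n) ∸ suc (2 * j)) !)
        ≡⟨ nCk*[k!*[n∸k]!]≡n! (s≤s (*-monoʳ-≤ 2 j≤n)) ⟩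
      (suc (2 * n)) ! ∎
    viaFall : 2 ^ j * fall n j * dfact (suc n) * (2 ^ d * d !) ≡ (suc (2 * n)) !
    viaFall = begin
      2 ^ j * fall n j * (suc (2 * n) * dfact n) * (2 ^ d * d !)
        ≡⟨ solve 6 (λ p f s df q g → p :* f :* (s :* df) :* (q :* g) := s :* (df :* ((p :* q) :* (f :* g)))) refl
             (2 ^ j) (fall n j) (suc (2 * n)) (dfact n) (2 ^ d) (d !) ⟩
      suc (2 * n) * (dfact n * ((2 ^ j * 2 ^ d) * (fall n j * d !)))
        ≡⟨ cong₂ (λ a b → suc (2 * n) * (dfact n * (a * b)))
                 (trans (sym (^-distribˡ-+-* 2 j d)) (cong (2 ^_) (m+[n∸m]≡n j≤n))) (fall*[n∸j]!≡n! n j j≤n) ⟩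
      suc (2 * n) * (dfact n * (2 ^ n * n !))
        ≡⟨ cong (suc (2 * n) *_) (dfact*[2^m*m!]≡[2m]! n) ⟩
      (suc (2 * n)) ! ∎

module NatToRational where

  open import Data.Integer as ℤ using (ℤ; +_)
  import Data.Integer.Properties as ℤ
  open import Data.Integer.GCD using (gcd)
  open import Data.Nat as ℕ using (ℕ; suc; NonZero)
  import Data.Nat.Properties as ℕ
  import Data.Nat.Coprimality as Coprime
  open import Data.Rational using (mkℚ; _/_; _+_; _*_; _-_; 0ℚ; 1ℚ; ↥_; ↧_; 1/_; ≢-nonZero)
  open import Data.Rational.Properties using (fromℚᵘ-cong; normalize-coprime; ↥-/; ↧-/; *-inverseʳ; *-assoc; *-identityʳ)
  open import Data.Rational.Solver using (module +-*-Solver)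
  open import Data.Rational.Unnormalised using (mkℚᵘ; *≡*)
  open import Relation.Binary.PropositionalEquality
  open import Defs using (ℕ→ℚ)
  open +-*-Solver

  private
    /-cross : ∀ (a c : ℤ) (b e : ℕ) → a ℤ.* + suc e ≡ c ℤ.* + suc b → a / suc b ≡ c / suc e
    /-cross a c b e eq = fromℚᵘ-cong {mkℚᵘ a b} {mkℚᵘ c e} (*≡* eq)

    ℕ→ℚ-mkℚ : ∀ n → ℕ→ℚ n ≡ mkℚ (+ n) 0 (Coprime.sym (Coprime.1-coprimeTo n))
    ℕ→ℚ-mkℚ n = normalize-coprime {n} {0} (Coprime.sym (Coprime.1-coprimeTo n))

  ℕ→ℚ-+ : ∀ a b → ℕ→ℚ (a ℕ.+ b) ≡ ℕ→ℚ a + ℕ→ℚ b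
  ℕ→ℚ-+ a b = sym (trans (cong₂ _+_ (ℕ→ℚ-mkℚ a) (ℕ→ℚ-mkℚ b)) (/-cross (+ a ℤ.* + 1 ℤ.+ + b ℤ.* + 1) (+ (a ℕ.+ b)) 0 0
    (cong (ℤ._* + 1) (trans (cong₂ ℤ._+_ (ℤ.*-identityʳ (+ a)) (ℤ.*-identityʳ (+ b))) (sym (ℤ.pos-+ a b))))))

  ℕ→ℚ-* : ∀ a b → ℕ→ℚ (a ℕ.* b) ≡ ℕ→ℚ a * ℕ→ℚ b
  ℕ→ℚ-* a b = sym (trans (cong₂ _*_ (ℕ→ℚ-mkℚ a) (ℕ→ℚ-mkℚ b)) (/-cross (+ a ℤ.* + b) (+ (a ℕ.* b)) 0 0 (cong (ℤ._* + 1) (sym (ℤ.pos-* a b)))))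

  ℕ→ℚ-∸ : ∀ a b → b ℕ.≤ a → ℕ→ℚ (a ℕ.∸ b) ≡ ℕ→ℚ a - ℕ→ℚ b
  ℕ→ℚ-∸ a b b≤a = begin
    ℕ→ℚ (a ℕ.∸ b)                   ≡⟨ solve 2 (λ x y → x := x :+ y :- y) refl (ℕ→ℚ (a ℕ.∸ b)) (ℕ→ℚ b) ⟩
    ℕ→ℚ (a ℕ.∸ b) + ℕ→ℚ b - ℕ→ℚ b  ≡⟨ cong (_- ℕ→ℚ b) (ℕ→ℚ-+ (a ℕ.∸ b) b) ⟨
    ℕ→ℚ (a ℕ.∸ b ℕ.+ b) - ℕ→ℚ b    ≡⟨ cong (λ z → ℕ→ℚ z - ℕ→ℚ b) (ℕ.m∸n+n≡m b≤a) ⟩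
    ℕ→ℚ a - ℕ→ℚ b                  ∎
    where open ≡-Reasoning

  ℕ→ℚ-≢0 : ∀ n .{{_ : NonZero n}} → ℕ→ℚ n ≢ 0ℚ
  ℕ→ℚ-≢0 (suc n) eq with () ← trans (sym (ℕ→ℚ-mkℚ (suc n))) eq

  n/d*d≡n : ∀ n d .{{_ : NonZero d}} → (+ n / d) * ℕ→ℚ d ≡ ℕ→ℚ n
  n/d*d≡n n (suc d) with + n / suc d in n/d
  ... | r@(mkℚ a b _) = trans (cong (r *_) (ℕ→ℚ-mkℚ (suc d))) (/-cross (a ℤ.* + suc d) (+ n) (b ℕ.* 1) 0 cross)
    where
    open ≡-Reasoning
    g : ℤ
    g = gcd (+ n) (+ suc d)
    a*g≡n : a ℤ.* g ≡ + n
    a*g≡n = subst (λ z → ↥ z ℤ.* g ≡ + n) n/d (↥-/ (+ n) (suc d))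
    b*g≡d : + suc b ℤ.* g ≡ + suc d
    b*g≡d = subst (λ z → ↧ z ℤ.* g ≡ + suc d) n/d (↧-/ (+ n) (suc d))
    cross : (a ℤ.* + suc d) ℤ.* + 1 ≡ + n ℤ.* + suc (b ℕ.* 1)
    cross = begin
      (a ℤ.* + suc d) ℤ.* + 1          ≡⟨ cong (λ z → (a ℤ.* z) ℤ.* + 1) (sym b*g≡d) ⟩
      (a ℤ.* (+ suc b ℤ.* g)) ℤ.* + 1  ≡⟨ trans (ℤ.*-identityʳ _) (trans (cong (a ℤ.*_) (ℤ.*-comm (+ suc b) g)) (sym (ℤ.*-assoc a g (+ suc b)))) ⟩
      (a ℤ.* g) ℤ.* + suc b            ≡⟨ cong₂ ℤ._*_ a*g≡n (cong (λ z → + suc z) (sym (ℕ.*-identityʳ b))) ⟩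
      + n ℤ.* + suc (b ℕ.* 1)          ∎

  *-cancelʳ : ∀ p q r → r ≢ 0ℚ → p * r ≡ q * r → p ≡ q
  *-cancelʳ p q r r≢0 eq = begin
    p                     ≡⟨ sym (*-identityʳ p) ⟩
    p * 1ℚ                ≡⟨ cong (p *_) (*-inverseʳ r) ⟨
    p * (r * 1/ r)        ≡⟨ *-assoc p r _ ⟨
    p * r * 1/ r          ≡⟨ cong (_* 1/ r) eq ⟩
    q * r * 1/ r          ≡⟨ *-assoc q r _ ⟩
    q * (r * 1/ r)        ≡⟨ cong (q *_) (*-inverseʳ r) ⟩
    q * 1ℚ                ≡⟨ *-identityʳ q ⟩
    q                     ∎
    where
    open ≡-Reasoning
    instance _ = ≢-nonZero r≢0

  n/d*m≡[n*m]/d : ∀ n d m .{{_ : NonZero d}} → (+ n / d) * ℕ→ℚ m ≡ + (n ℕ.* m) / d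
  n/d*m≡[n*m]/d n d m = *-cancelʳ _ _ (ℕ→ℚ d) (ℕ→ℚ-≢0 d) (begin
    (+ n / d) * ℕ→ℚ m * ℕ→ℚ d  ≡⟨ solve 3 (λ a b c → a :* b :* c := a :* c :* b) refl (+ n / d) (ℕ→ℚ m) (ℕ→ℚ d) ⟩
    (+ n / d) * ℕ→ℚ d * ℕ→ℚ m  ≡⟨ cong (_* ℕ→ℚ m) (n/d*d≡n n d) ⟩
    ℕ→ℚ n * ℕ→ℚ m              ≡⟨ ℕ→ℚ-* n m ⟨
    ℕ→ℚ (n ℕ.* m)              ≡⟨ n/d*d≡n (n ℕ.* m) d ⟨
    (+ (n ℕ.* m) / d) * ℕ→ℚ d  ∎)
    where open ≡-Reasoning

module Polynomials where

  open import Data.Integer using (+_)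
  open import Data.List using (List; []; _∷_; map)
  open import Data.Nat as ℕ using (ℕ; zero; suc)
  open import Data.Rational using (ℚ; _/_; _+_; _*_; _-_; -_; 0ℚ; 1ℚ)
  open import Data.Rational.Solver using (module +-*-Solver)
  open import Relation.Binary.PropositionalEquality
  open import Defs using (Poly; eval; ℕ→ℚ)
  open NatToRational
  open +-*-Solver

  addP : Poly → Poly → Poly
  addP []       q        = q
  addP (c ∷ p)  []       = c ∷ p
  addP (c ∷ p)  (d ∷ q)  = (c + d) ∷ addP p q

  eval-addP : ∀ p q x → eval (addP p q) x ≡ eval p x + eval q x
  eval-addP []      q       x = solve 1 (λ e → e := con 0ℚ :+ e) refl (eval q x)
  eval-addP (c ∷ p) []      x = solve 1 (λ e → e := e :+ con 0ℚ) refl (eval (c ∷ p) x)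
  eval-addP (c ∷ p) (d ∷ q) x = trans (cong (λ z → c + d + x * z) (eval-addP p q x))
    (solve 5 (λ c d x a b → c :+ d :+ x :* (a :+ b) := (c :+ x :* a) :+ (d :+ x :* b)) refl c d x (eval p x) (eval q x))

  scaleP : ℚ → Poly → Poly
  scaleP a = map (a *_)

  eval-scaleP : ∀ a p x → eval (scaleP a p) x ≡ a * eval p x
  eval-scaleP a []      x = solve 1 (λ a → con 0ℚ := a :* con 0ℚ) refl a
  eval-scaleP a (c ∷ p) x = trans (cong (λ z → a * c + x * z) (eval-scaleP a p x))
    (solve 4 (λ a c x e → a :* c :+ x :* (a :* e) := a :* (c :+ x :* e)) refl a c x (eval p x))

  mulLinear : ℚ → Poly → Poly
  mulLinear r p = addP (0ℚ ∷ p) (scaleP (- r) p)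

  eval-mulLinear : ∀ r p x → eval (mulLinear r p) x ≡ (x - r) * eval p x
  eval-mulLinear r p x = trans (eval-addP (0ℚ ∷ p) (scaleP (- r) p) x) (trans (cong (λ z → 0ℚ + x * eval p x + z) (eval-scaleP (- r) p x))
    (solve 3 (λ r x e → con 0ℚ :+ x :* e :+ (:- r) :* e := (x :- r) :* e) refl r x (eval p x)))

  shiftP : ℚ → Poly → Poly
  shiftP a []      = []
  shiftP a (c ∷ p) = addP (c ∷ []) (mulLinear (- a) (shiftP a p))

  eval-shiftP : ∀ a p x → eval (shiftP a p) x ≡ eval p (x + a)
  eval-shiftP a []      x = refl
  eval-shiftP a (c ∷ p) x = trans (eval-addP (c ∷ []) (mulLinear (- a) (shiftP a p)) x)
    (trans (cong (λ z → c + x * 0ℚ + z) (trans (eval-mulLinear (- a) (shiftP a p) x) (cong ((x - - a) *_) (eval-shiftP a p x))))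
           (solve 4 (λ c x a e → c :+ x :* con 0ℚ :+ (x :- (:- a)) :* e := c :+ (x :+ a) :* e) refl c x a (eval p (x + a))))

  rising : ℕ → ℚ → ℚ
  rising zero    x = 1ℚ
  rising (suc i) x = x * rising i (x + 1ℚ)

  rising-suc : ∀ i x → rising (suc i) x ≡ rising i x * (x + ℕ→ℚ i)
  rising-suc zero    x = solve 1 (λ x → x :* con 1ℚ := con 1ℚ :* (x :+ con 0ℚ)) refl x
  rising-suc (suc i) x = begin
    x * rising (suc i) (x + 1ℚ)                ≡⟨ cong (x *_) (rising-suc i (x + 1ℚ)) ⟩
    x * (rising i (x + 1ℚ) * (x + 1ℚ + ℕ→ℚ i)) ≡⟨ solve 3 (λ x r q → x :* (r :* (x :+ con 1ℚ :+ q)) := x :* r :* (x :+ (con 1ℚ :+ q))) refl x (rising i (x + 1ℚ)) (ℕ→ℚ i) ⟩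
    x * rising i (x + 1ℚ) * (x + (1ℚ + ℕ→ℚ i)) ≡⟨ cong (λ z → x * rising i (x + 1ℚ) * (x + z)) (ℕ→ℚ-+ 1 i) ⟨
    x * rising i (x + 1ℚ) * (x + ℕ→ℚ (suc i))  ∎
    where open ≡-Reasoning

  rising-Δ : ∀ i x → rising (suc i) x - rising (suc i) (x - 1ℚ) ≡ ℕ→ℚ (suc i) * rising i x
  rising-Δ i x = begin
    rising (suc i) x - (x - 1ℚ) * rising i (x - 1ℚ + 1ℚ)
      ≡⟨ cong₂ (λ a b → a - (x - 1ℚ) * rising i b) (rising-suc i x) (solve 1 (λ x → x :- con 1ℚ :+ con 1ℚ := x) refl x) ⟩
    rising i x * (x + ℕ→ℚ i) - (x - 1ℚ) * rising i x
      ≡⟨ solve 3 (λ r x q → r :* (x :+ q) :- (x :- con 1ℚ) :* r := (con 1ℚ :+ q) :* r) refl (rising i x) x (ℕ→ℚ i) ⟩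
    (1ℚ + ℕ→ℚ i) * rising i x
      ≡⟨ cong (_* rising i x) (ℕ→ℚ-+ 1 i) ⟨
    ℕ→ℚ (suc i) * rising i x ∎
    where open ≡-Reasoning

  -- Coefficients with respect to the basis rising i, rising (i + 1), …; there the difference operator is a shift.
  evalRising : ℕ → List ℚ → ℚ → ℚ
  evalRising i []       x = 0ℚ
  evalRising i (d ∷ ds) x = d * rising i x + evalRising (suc i) ds x

  addHead : ℚ → List ℚ → List ℚ
  addHead d []       = d ∷ []
  addHead d (e ∷ es) = (d + e) ∷ es

  evalRising-addHead : ∀ i d es x → evalRising i (addHead d es) x ≡ d * rising i x + evalRising i es x
  evalRising-addHead i d []       x = refl
  evalRising-addHead i d (e ∷ es) x =
    solve 4 (λ d e r s → (d :+ e) :* r :+ s := d :* r :+ (e :* r :+ s)) refl d e (rising i x) (evalRising (suc i) es x)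

  mulXRising : ℕ → List ℚ → List ℚ
  mulXRising i []       = []
  mulXRising i (d ∷ ds) = (- (ℕ→ℚ i * d)) ∷ addHead d (mulXRising (suc i) ds)

  evalRising-mulX : ∀ i ds x → evalRising i (mulXRising i ds) x ≡ x * evalRising i ds x
  evalRising-mulX i []       x = solve 1 (λ x → con 0ℚ := x :* con 0ℚ) refl x
  evalRising-mulX i (d ∷ ds) x = begin
    - (ℕ→ℚ i * d) * rising i x + evalRising (suc i) (addHead d (mulXRising (suc i) ds)) x
      ≡⟨ cong (λ z → - (ℕ→ℚ i * d) * rising i x + z)
              (trans (evalRising-addHead (suc i) d (mulXRising (suc i) ds) x) (cong₂ (λ a b → d * a + b) (rising-suc i x) (evalRising-mulX (suc i) ds x))) ⟩
    - (ℕ→ℚ i * d) * rising i x + (d * (rising i x * (x + ℕ→ℚ i)) + x * evalRising (suc i) ds x)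
      ≡⟨ solve 5 (λ q d r x e → :- (q :* d) :* r :+ (d :* (r :* (x :+ q)) :+ x :* e) := x :* (d :* r :+ e)) refl
           (ℕ→ℚ i) d (rising i x) x (evalRising (suc i) ds x) ⟩
    x * (d * rising i x + evalRising (suc i) ds x) ∎
    where open ≡-Reasoning

  toRising : Poly → List ℚ
  toRising []      = []
  toRising (c ∷ p) = addHead c (mulXRising 0 (toRising p))

  evalRising-toRising : ∀ p x → evalRising 0 (toRising p) x ≡ eval p x
  evalRising-toRising []      x = refl
  evalRising-toRising (c ∷ p) x =
    trans (evalRising-addHead 0 c (mulXRising 0 (toRising p)) x)
          (trans (cong (λ z → c * 1ℚ + z) (trans (evalRising-mulX 0 (toRising p) x) (cong (x *_) (evalRising-toRising p x))))
                 (solve 3 (λ c x e → c :* con 1ℚ :+ x :* e := c :+ x :* e) refl c x (eval p x)))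

  antiRising : ℕ → List ℚ → List ℚ
  antiRising i []       = []
  antiRising i (d ∷ ds) = (d * (+ 1 / suc i)) ∷ antiRising (suc i) ds

  antiRising-Δ : ∀ i ds x → evalRising (suc i) (antiRising i ds) x - evalRising (suc i) (antiRising i ds) (x - 1ℚ) ≡ evalRising i ds x
  antiRising-Δ i []       x = solve 0 (con 0ℚ :- con 0ℚ := con 0ℚ) refl
  antiRising-Δ i (d ∷ ds) x = begin
    (d * c * R x + A x) - (d * c * R (x - 1ℚ) + A (x - 1ℚ))
      ≡⟨ solve 6 (λ d c r r′ a a′ → (d :* c :* r :+ a) :- (d :* c :* r′ :+ a′) := d :* c :* (r :- r′) :+ (a :- a′)) refl
           d c (R x) (R (x - 1ℚ)) (A x) (A (x - 1ℚ)) ⟩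
    d * c * (R x - R (x - 1ℚ)) + (A x - A (x - 1ℚ))
      ≡⟨ cong₂ (λ a b → d * c * a + b) (rising-Δ i x) (antiRising-Δ (suc i) ds x) ⟩
    d * c * (ℕ→ℚ (suc i) * rising i x) + evalRising (suc i) ds x
      ≡⟨ solve 5 (λ d c q r e → d :* c :* (q :* r) :+ e := d :* (c :* q) :* r :+ e) refl d c (ℕ→ℚ (suc i)) (rising i x) (evalRising (suc i) ds x) ⟩
    d * (c * ℕ→ℚ (suc i)) * rising i x + evalRising (suc i) ds x
      ≡⟨ cong (λ z → d * z * rising i x + evalRising (suc i) ds x) (n/d*d≡n 1 (suc i)) ⟩
    d * 1ℚ * rising i x + evalRising (suc i) ds x
      ≡⟨ cong (λ z → z * rising i x + evalRising (suc i) ds x) (solve 1 (λ d → d :* con 1ℚ := d) refl d) ⟩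
    d * rising i x + evalRising (suc i) ds x ∎
    where
    open ≡-Reasoning
    c : ℚ
    R A : ℚ → ℚ
    c = + 1 / suc i
    R = rising (suc i)
    A = evalRising (suc (suc i)) (antiRising (suc i) ds)

  risingP : ℕ → Poly
  risingP zero    = 1ℚ ∷ []
  risingP (suc i) = mulLinear (- ℕ→ℚ i) (risingP i)

  eval-risingP : ∀ i x → eval (risingP i) x ≡ rising i x
  eval-risingP zero    x = solve 1 (λ x → con 1ℚ :+ x :* con 0ℚ := con 1ℚ) refl x
  eval-risingP (suc i) x = trans (eval-mulLinear (- ℕ→ℚ i) (risingP i) x) (trans (cong ((x - - ℕ→ℚ i) *_) (eval-risingP i x))
    (trans (solve 3 (λ x q r → (x :- (:- q)) :* r := r :* (x :+ q)) refl x (ℕ→ℚ i) (rising i x)) (sym (rising-suc i x))))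

  fromRising : ℕ → List ℚ → Poly
  fromRising i []       = []
  fromRising i (d ∷ ds) = addP (scaleP d (risingP i)) (fromRising (suc i) ds)

  eval-fromRising : ∀ i ds x → eval (fromRising i ds) x ≡ evalRising i ds x
  eval-fromRising i []       x = refl
  eval-fromRising i (d ∷ ds) x = trans (eval-addP (scaleP d (risingP i)) (fromRising (suc i) ds) x)
    (cong₂ _+_ (trans (eval-scaleP d (risingP i) x) (cong (d *_) (eval-risingP i x))) (eval-fromRising (suc i) ds x))

  antidifference : Poly → Poly
  antidifference g = fromRising 1 (antiRising 0 (toRising g))

  antidifference-Δ : ∀ g x → eval (antidifference g) x - eval (antidifference g) (x - 1ℚ) ≡ eval g x
  antidifference-Δ g x = trans (cong₂ _-_ (eval-fromRising 1 (antiRising 0 (toRising g)) x) (eval-fromRising 1 (antiRising 0 (toRising g)) (x - 1ℚ)))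
    (trans (antiRising-Δ 0 (toRising g) x) (evalRising-toRising g x))

module PolynomialFamily where

  open import Algebra.Bundles using (CommutativeRing)
  open import Data.Bool using (if_then_else_)
  open import Data.Integer as ℤ using ()
  open import Data.List using ([]; _∷_; map; foldr; upTo; _++_)
  open import Data.List.Properties using (upTo-∷ʳ; map-++; foldr-++)
  open import Data.Nat as ℕ using (ℕ; zero; suc; _≤_; _<_; s≤s)
  import Data.Nat.Properties as ℕ
  open import Data.Rational using (ℚ; _/_; _+_; _*_; _-_; -_; 0ℚ; 1ℚ)
  open import Data.Rational.Properties using (+-*-commutativeRing; +-identityʳ; +-assoc; *-comm; *-assoc)
  open import Data.Rational.Solver using (module +-*-Solver)
  open import Data.Sum using (inj₁; inj₂)
  open import Relation.Binary.PropositionalEquality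
  open import Defs using (Poly; eval; ℕ→ℚ; fall; fact-nz; B1; leadTerm; sumFT)
  open NatBool using (≤⇒≤ᵇ-true; ≥⇒<ᵇ-false)
  open NatToRational
  open Polynomials
  open RangeSum (CommutativeRing.commutativeSemiring +-*-commutativeRing)
  open +-*-Solver using (solve; _:=_; _:+_; _:*_; _:-_; con)

  private
    foldr-+-init : ∀ (f : ℕ → ℚ) c ts → foldr (λ t acc → f t + acc) c ts ≡ foldr (λ t acc → f t + acc) 0ℚ ts + c
    foldr-+-init f c []       = solve 1 (λ c → c := con 0ℚ :+ c) refl c
    foldr-+-init f c (t ∷ ts) = trans (cong (f t +_) (foldr-+-init f c ts)) (sym (+-assoc (f t) _ c))

    foldr-+-range : ∀ a n (f : ℕ → ℚ) → foldr (λ t acc → f t + acc) 0ℚ (map (a ℕ.+_) (upTo n)) ≡ ∑[ i < n ] f (a ℕ.+ i)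
    foldr-+-range a zero    f = refl
    foldr-+-range a (suc n) f = begin
      foldr g 0ℚ (map (a ℕ.+_) (upTo (suc n)))               ≡⟨ cong (λ l → foldr g 0ℚ (map (a ℕ.+_) l)) (upTo-∷ʳ n) ⟨
      foldr g 0ℚ (map (a ℕ.+_) (upTo n ++ n ∷ []))            ≡⟨ cong (foldr g 0ℚ) (map-++ (a ℕ.+_) (upTo n) (n ∷ [])) ⟩
      foldr g 0ℚ (map (a ℕ.+_) (upTo n) ++ (a ℕ.+ n) ∷ [])    ≡⟨ foldr-++ g 0ℚ (map (a ℕ.+_) (upTo n)) _ ⟩
      foldr g (f (a ℕ.+ n) + 0ℚ) (map (a ℕ.+_) (upTo n))      ≡⟨ foldr-+-init f _ (map (a ℕ.+_) (upTo n)) ⟩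
      foldr g 0ℚ (map (a ℕ.+_) (upTo n)) + (f (a ℕ.+ n) + 0ℚ) ≡⟨ cong₂ _+_ (foldr-+-range a n f) (+-identityʳ _) ⟩
      ∑[ i < suc n ] f (a ℕ.+ i)                              ∎
      where
      open ≡-Reasoning
      g : ℕ → ℚ → ℚ
      g t acc = f t + acc

  sumFT≡∑ : ∀ a b f → sumFT a b f ≡ ∑[ i < suc b ℕ.∸ a ] f (a ℕ.+ i)
  sumFT≡∑ a b f = foldr-+-range a (suc b ℕ.∸ a) f

  fallQ : ℕ → ℚ → ℚ
  fallQ zero    x = 1ℚ
  fallQ (suc j) x = (x - ℕ→ℚ (suc j)) * fallQ j x

  fallQ-fall : ∀ j t → j < t → fallQ j (ℕ→ℚ t) ≡ ℕ→ℚ (fall (t ℕ.∸ 1) j)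
  fallQ-fall zero    t _     = refl
  fallQ-fall (suc j) t 1+j<t = begin
    (ℕ→ℚ t - ℕ→ℚ (suc j)) * fallQ j (ℕ→ℚ t)                 ≡⟨ cong₂ _*_ t-1-j (fallQ-fall j t (ℕ.<-trans (ℕ.n<1+n j) 1+j<t)) ⟩
    ℕ→ℚ ((t ℕ.∸ 1) ℕ.∸ j) * ℕ→ℚ (fall (t ℕ.∸ 1) j)          ≡⟨ *-comm (ℕ→ℚ ((t ℕ.∸ 1) ℕ.∸ j)) _ ⟩
    ℕ→ℚ (fall (t ℕ.∸ 1) j) * ℕ→ℚ ((t ℕ.∸ 1) ℕ.∸ j)          ≡⟨ ℕ→ℚ-* (fall (t ℕ.∸ 1) j) _ ⟨
    ℕ→ℚ (fall (t ℕ.∸ 1) (suc j))                           ∎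
    where
    open ≡-Reasoning
    t-1-j : ℕ→ℚ t - ℕ→ℚ (suc j) ≡ ℕ→ℚ ((t ℕ.∸ 1) ℕ.∸ j)
    t-1-j = trans (sym (ℕ→ℚ-∸ t (suc j) (ℕ.<⇒≤ 1+j<t))) (cong ℕ→ℚ (sym (ℕ.∸-+-assoc t 1 j)))

  mulFallP : ℕ → Poly → Poly
  mulFallP zero    p = p
  mulFallP (suc j) p = mulLinear (ℕ→ℚ (suc j)) (mulFallP j p)

  eval-mulFallP : ∀ j p x → eval (mulFallP j p) x ≡ fallQ j x * eval p x
  eval-mulFallP zero    p x = solve 1 (λ e → e := con 1ℚ :* e) refl (eval p x)
  eval-mulFallP (suc j) p x = trans (eval-mulLinear (ℕ→ℚ (suc j)) (mulFallP j p) x)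
    (trans (cong ((x - ℕ→ℚ (suc j)) *_) (eval-mulFallP j p x))
           (solve 3 (λ a b c → a :* (b :* c) := a :* b :* c) refl (x - ℕ→ℚ (suc j)) (fallQ j x) (eval p x)))

  coeff : ℕ → ℚ
  coeff j = (ℤ.+ (B1 j ℕ.* 2 ℕ.^ j) / (suc (2 ℕ.* j)) ℕ.!) {{fact-nz (suc (2 ℕ.* j))}}

  weight : ℕ → ℕ → ℚ
  weight j t = (ℤ.+ (B1 j ℕ.* 2 ℕ.^ j ℕ.* fall (t ℕ.∸ 1) j) / (suc (2 ℕ.* j)) ℕ.!) {{fact-nz (suc (2 ℕ.* j))}}

  summandP : (ℕ → Poly) → ℕ → ℕ → Poly
  summandP q k j = scaleP (coeff j) (mulFallP j (shiftP (- ℕ→ℚ (suc j)) (q (k ℕ.∸ j))))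

  eval-summandP : ∀ q k j t → j < t → eval (summandP q k j) (ℕ→ℚ t) ≡ weight j t * eval (q (k ℕ.∸ j)) (ℕ→ℚ (t ℕ.∸ j ℕ.∸ 1))
  eval-summandP q k j t j<t = begin
    eval (summandP q k j) (ℕ→ℚ t)
      ≡⟨ eval-scaleP (coeff j) (mulFallP j (shiftP (- ℕ→ℚ (suc j)) p)) (ℕ→ℚ t) ⟩
    coeff j * eval (mulFallP j (shiftP (- ℕ→ℚ (suc j)) p)) (ℕ→ℚ t)
      ≡⟨ cong (coeff j *_) (eval-mulFallP j (shiftP (- ℕ→ℚ (suc j)) p) (ℕ→ℚ t)) ⟩
    coeff j * (fallQ j (ℕ→ℚ t) * eval (shiftP (- ℕ→ℚ (suc j)) p) (ℕ→ℚ t))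
      ≡⟨ cong₂ (λ a b → coeff j * (a * b)) (fallQ-fall j t j<t) (eval-shiftP (- ℕ→ℚ (suc j)) p (ℕ→ℚ t)) ⟩
    coeff j * (ℕ→ℚ (fall (t ℕ.∸ 1) j) * eval p (ℕ→ℚ t + - ℕ→ℚ (suc j)))
      ≡⟨ *-assoc (coeff j) (ℕ→ℚ (fall (t ℕ.∸ 1) j)) _ ⟨
    coeff j * ℕ→ℚ (fall (t ℕ.∸ 1) j) * eval p (ℕ→ℚ t - ℕ→ℚ (suc j))
      ≡⟨ cong₂ _*_ (n/d*m≡[n*m]/d (B1 j ℕ.* 2 ℕ.^ j) ((suc (2 ℕ.* j)) ℕ.!) (fall (t ℕ.∸ 1) j) {{fact-nz (suc (2 ℕ.* j))}})
                   (cong (eval p) t-1-j) ⟩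
    weight j t * eval p (ℕ→ℚ (t ℕ.∸ j ℕ.∸ 1)) ∎
    where
    open ≡-Reasoning
    p : Poly
    p = q (k ℕ.∸ j)
    t-1-j : ℕ→ℚ t - ℕ→ℚ (suc j) ≡ ℕ→ℚ (t ℕ.∸ j ℕ.∸ 1)
    t-1-j = trans (sym (ℕ→ℚ-∸ t (suc j) j<t)) (cong ℕ→ℚ (trans (cong (t ℕ.∸_) (ℕ.+-comm 1 j)) (sym (ℕ.∸-+-assoc t j 1))))

  summandsP : (ℕ → Poly) → ℕ → ℕ → Poly
  summandsP q k zero    = []
  summandsP q k (suc i) = addP (summandsP q k i) (summandP q k (suc i))

  eval-summandsP : ∀ q k i x → eval (summandsP q k i) x ≡ ∑[ i′ < i ] eval (summandP q k (suc i′)) x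
  eval-summandsP q k zero    x = refl
  eval-summandsP q k (suc i) x =
    trans (eval-addP (summandsP q k i) (summandP q k (suc i)) x) (cong (_+ eval (summandP q k (suc i)) x) (eval-summandsP q k i x))

  -- The constant is chosen so that the value at x = k + 1 is leadTerm k.
  nextP : (ℕ → Poly) → ℕ → Poly
  nextP q k = addP ((leadTerm k - eval A (ℕ→ℚ (suc k))) ∷ []) A
    where A = antidifference (summandsP q k k)

  -- table K i = poly i for i ≤ K; each new polynomial is built from all the earlier ones.
  table : ℕ → ℕ → Poly
  table zero    i = 1ℚ ∷ []
  table (suc K) i = if i ℕ.≤ᵇ K then table K i else nextP (table K) (suc K)

  poly : ℕ → Poly
  poly k = table k k

  table≡poly : ∀ K i → i ≤ K → table K i ≡ poly i
  table≡poly K i i≤K with ℕ.m≤n⇒m<n∨m≡n i≤K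
  ... | inj₂ refl = refl
  table≡poly (suc K) i _ | inj₁ (s≤s i≤K) =
    trans (cong (λ b → if b then table K i else nextP (table K) (suc K)) (≤⇒≤ᵇ-true i≤K)) (table≡poly K i i≤K)

  poly-suc : ∀ K → poly (suc K) ≡ nextP (table K) (suc K)
  poly-suc K = cong (λ b → if b then table K (suc K) else nextP (table K) (suc K)) (≥⇒<ᵇ-false (ℕ.≤-refl {K}))

  eval-nextP : ∀ q k x → eval (nextP q k) x
    ≡ (leadTerm k - eval (antidifference (summandsP q k k)) (ℕ→ℚ (suc k))) + x * 0ℚ + eval (antidifference (summandsP q k k)) x
  eval-nextP q k x = eval-addP ((leadTerm k - eval (antidifference (summandsP q k k)) (ℕ→ℚ (suc k))) ∷ []) (antidifference (summandsP q k k)) x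

  poly-first : ∀ k → eval (poly k) (ℕ→ℚ (suc k)) ≡ leadTerm k
  poly-first zero    = refl
  poly-first (suc K) = trans (cong (λ p → eval p (ℕ→ℚ (suc (suc K)))) (poly-suc K)) (trans (eval-nextP (table K) (suc K) (ℕ→ℚ (suc (suc K))))
    (solve 3 (λ l a y → l :- a :+ y :* con 0ℚ :+ a := l) refl
       (leadTerm (suc K)) (eval (antidifference (summandsP (table K) (suc K) (suc K))) (ℕ→ℚ (suc (suc K)))) (ℕ→ℚ (suc (suc K)))))

  polyStep : ℕ → ℕ → ℚ
  polyStep k n = ∑[ i < k ] (weight (suc i) (suc n) * eval (poly (k ℕ.∸ suc i)) (ℕ→ℚ (suc n ℕ.∸ suc i ℕ.∸ 1)))

  poly-suc-arg : ∀ k n → suc k ≤ n → eval (poly k) (ℕ→ℚ (suc n)) ≡ eval (poly k) (ℕ→ℚ n) + polyStep k n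
  poly-suc-arg zero    n _ = solve 2 (λ x y → con 1ℚ :+ x :* con 0ℚ := con 1ℚ :+ y :* con 0ℚ :+ con 0ℚ) refl (ℕ→ℚ (suc n)) (ℕ→ℚ n)
  poly-suc-arg (suc K) n k<n = begin
    eval (poly k) (ℕ→ℚ (suc n))                             ≡⟨ cong (λ p → eval p (ℕ→ℚ (suc n))) (poly-suc K) ⟩
    eval (nextP q k) (ℕ→ℚ (suc n))                          ≡⟨ eval-nextP q k (ℕ→ℚ (suc n)) ⟩
    c + ℕ→ℚ (suc n) * 0ℚ + A (ℕ→ℚ (suc n))
      ≡⟨ solve 5 (λ c x x′ a a′ → c :+ x :* con 0ℚ :+ a := c :+ x′ :* con 0ℚ :+ a′ :+ (a :- a′)) refl
           c (ℕ→ℚ (suc n)) (ℕ→ℚ (suc n) - 1ℚ) (A (ℕ→ℚ (suc n))) (A (ℕ→ℚ (suc n) - 1ℚ)) ⟩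
    c + (ℕ→ℚ (suc n) - 1ℚ) * 0ℚ + A (ℕ→ℚ (suc n) - 1ℚ) + (A (ℕ→ℚ (suc n)) - A (ℕ→ℚ (suc n) - 1ℚ))
      ≡⟨ cong₂ _+_ (sym (trans (eval-nextP q k (ℕ→ℚ n)) (cong (λ z → c + z * 0ℚ + A z) n≡1+n-1)))
                   (antidifference-Δ (summandsP q k k) (ℕ→ℚ (suc n))) ⟩
    eval (nextP q k) (ℕ→ℚ n) + eval (summandsP q k k) (ℕ→ℚ (suc n))
      ≡⟨ cong₂ _+_ (cong (λ p → eval p (ℕ→ℚ n)) (sym (poly-suc K))) (eval-summandsP q k k (ℕ→ℚ (suc n))) ⟩
    eval (poly k) (ℕ→ℚ n) + ∑[ i < k ] eval (summandP q k (suc i)) (ℕ→ℚ (suc n))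
      ≡⟨ cong (eval (poly k) (ℕ→ℚ n) +_) (∑-cong k summand) ⟩
    eval (poly k) (ℕ→ℚ n) + polyStep k n ∎
    where
    open ≡-Reasoning
    k : ℕ
    q : ℕ → Poly
    A : ℚ → ℚ
    c : ℚ
    k = suc K
    q = table K
    A = eval (antidifference (summandsP q k k))
    c = leadTerm k - A (ℕ→ℚ (suc k))
    n≡1+n-1 : ℕ→ℚ n ≡ ℕ→ℚ (suc n) - 1ℚ
    n≡1+n-1 = trans (solve 1 (λ x → x := con 1ℚ :+ x :- con 1ℚ) refl (ℕ→ℚ n)) (cong (_- 1ℚ) (sym (ℕ→ℚ-+ 1 n)))
    summand : ∀ i → i < k → eval (summandP q k (suc i)) (ℕ→ℚ (suc n))
                          ≡ weight (suc i) (suc n) * eval (poly (k ℕ.∸ suc i)) (ℕ→ℚ (suc n ℕ.∸ suc i ℕ.∸ 1))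
    summand i i<k = trans (eval-summandP q k (suc i) (suc n) (s≤s (ℕ.≤-trans i<k (ℕ.<⇒≤ k<n))))
      (cong (λ p → weight (suc i) (suc n) * eval p (ℕ→ℚ (suc n ℕ.∸ suc i ℕ.∸ 1))) (table≡poly K (K ℕ.∸ i) (ℕ.m∸n≤m K i)))

module ClosedForm where

  open import Algebra.Bundles using (CommutativeRing)
  open import Data.Nat as ℕ using (ℕ; zero; suc; _≤_; _<_; s≤s)
  open import Data.Nat.Combinatorics using (_C_)
  open import Data.Nat.Induction using (<-rec)
  import Data.Nat.Properties as ℕ
  import Data.Nat.Solver as ℕ-Solver
  open import Data.Rational using (ℚ; _+_; _*_; 0ℚ; 1ℚ)
  open import Data.Rational.Properties using (+-*-commutativeRing; +-identityʳ; +-assoc)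
  open import Data.Rational.Solver using (module +-*-Solver)
  open import Relation.Binary.PropositionalEquality
  open import Defs
  open UpDown using (euler)
  open UpDownMmp using (A=≡upDownMmp; B1≡euler)
  open Diagonal using (α; α-suc; α-first)
  open DoubleFactorial using (oddChoose-dfact)
  open NatToRational
  open PolynomialFamily
  open RangeSum (CommutativeRing.commutativeSemiring +-*-commutativeRing)
  open +-*-Solver using (solve; _:=_; _:+_; _:*_; con)
  module ℕΣ = RangeSum ℕ.+-*-commutativeSemiring

  ℕ→ℚ-∑ : ∀ n f → ℕ→ℚ (ℕΣ.∑< n f) ≡ ∑[ i < n ] ℕ→ℚ (f i)
  ℕ→ℚ-∑ zero    f = refl
  ℕ→ℚ-∑ (suc n) f = trans (ℕ→ℚ-+ (ℕΣ.∑< n f) (f n)) (cong (_+ ℕ→ℚ (f n)) (ℕ→ℚ-∑ n f))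

  weight-dfact : ∀ n j → j ≤ n →
    weight j (suc n) * ℕ→ℚ (dfact (suc n)) ≡ ℕ→ℚ ((suc (2 ℕ.* n) C suc (2 ℕ.* j)) ℕ.* euler (suc (2 ℕ.* j)) ℕ.* dfact (n ℕ.∸ j))
  weight-dfact n j j≤n = *-cancelʳ _ _ (ℕ→ℚ F) (ℕ→ℚ-≢0 F) (begin
    weight j (suc n) * ℕ→ℚ (dfact (suc n)) * ℕ→ℚ F
      ≡⟨ solve 3 (λ a b c → a :* b :* c := a :* c :* b) refl (weight j (suc n)) (ℕ→ℚ (dfact (suc n))) (ℕ→ℚ F) ⟩
    weight j (suc n) * ℕ→ℚ F * ℕ→ℚ (dfact (suc n))
      ≡⟨ cong (_* ℕ→ℚ (dfact (suc n))) (n/d*d≡n (B1 j ℕ.* 2 ℕ.^ j ℕ.* fall n j) F) ⟩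
    ℕ→ℚ (B1 j ℕ.* 2 ℕ.^ j ℕ.* fall n j) * ℕ→ℚ (dfact (suc n))
      ≡⟨ ℕ→ℚ-* (B1 j ℕ.* 2 ℕ.^ j ℕ.* fall n j) (dfact (suc n)) ⟨
    ℕ→ℚ (B1 j ℕ.* 2 ℕ.^ j ℕ.* fall n j ℕ.* dfact (suc n))
      ≡⟨ cong ℕ→ℚ integral ⟩
    ℕ→ℚ ((suc (2 ℕ.* n) C suc (2 ℕ.* j)) ℕ.* E ℕ.* dfact (n ℕ.∸ j) ℕ.* F)
      ≡⟨ ℕ→ℚ-* ((suc (2 ℕ.* n) C suc (2 ℕ.* j)) ℕ.* E ℕ.* dfact (n ℕ.∸ j)) F ⟩
    ℕ→ℚ ((suc (2 ℕ.* n) C suc (2 ℕ.* j)) ℕ.* E ℕ.* dfact (n ℕ.∸ j)) * ℕ→ℚ F ∎)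
    where
    open ≡-Reasoning
    F E : ℕ
    F = (suc (2 ℕ.* j)) ℕ.!
    E = euler (suc (2 ℕ.* j))
    instance _ = fact-nz (suc (2 ℕ.* j))
    open ℕ-Solver.+-*-Solver using () renaming (solve to ℕsolve; _:*_ to _⊛_; _:=_ to _⩦_)
    integral : B1 j ℕ.* 2 ℕ.^ j ℕ.* fall n j ℕ.* dfact (suc n) ≡ (suc (2 ℕ.* n) C suc (2 ℕ.* j)) ℕ.* E ℕ.* dfact (n ℕ.∸ j) ℕ.* F
    integral = begin
      B1 j ℕ.* 2 ℕ.^ j ℕ.* fall n j ℕ.* dfact (suc n)      ≡⟨ cong (λ b → b ℕ.* 2 ℕ.^ j ℕ.* fall n j ℕ.* dfact (suc n)) (B1≡euler j) ⟩
      E ℕ.* 2 ℕ.^ j ℕ.* fall n j ℕ.* dfact (suc n)         ≡⟨ ℕsolve 4 (λ e p f d → e ⊛ p ⊛ f ⊛ d ⩦ e ⊛ (p ⊛ f ⊛ d)) refl E (2 ℕ.^ j) (fall n j) (dfact (suc n)) ⟩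
      E ℕ.* (2 ℕ.^ j ℕ.* fall n j ℕ.* dfact (suc n))       ≡⟨ cong (E ℕ.*_) (oddChoose-dfact n j j≤n) ⟨
      E ℕ.* ((suc (2 ℕ.* n) C suc (2 ℕ.* j)) ℕ.* F ℕ.* dfact (n ℕ.∸ j))
        ≡⟨ ℕsolve 4 (λ e b f d → e ⊛ (b ⊛ f ⊛ d) ⩦ b ⊛ e ⊛ d ⊛ f) refl E (suc (2 ℕ.* n) C suc (2 ℕ.* j)) F (dfact (n ℕ.∸ j)) ⟩
      (suc (2 ℕ.* n) C suc (2 ℕ.* j)) ℕ.* E ℕ.* dfact (n ℕ.∸ j) ℕ.* F ∎

  AlphaValue : ℕ → ℕ → Set
  AlphaValue k n = ℕ→ℚ (α k n) ≡ eval (poly k) (ℕ→ℚ n) * ℕ→ℚ (dfact n)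

  alpha-first : ∀ k → AlphaValue k (suc k)
  alpha-first k = begin
    ℕ→ℚ (α k (suc k))                                        ≡⟨ cong ℕ→ℚ (trans (α-first k) (sym (B1≡euler k))) ⟩
    ℕ→ℚ (B1 k)                                               ≡⟨ n/d*d≡n (B1 k) (dfact (suc k)) {{dfact-nz (suc k)}} ⟨
    leadTerm k * ℕ→ℚ (dfact (suc k))                         ≡⟨ cong (_* ℕ→ℚ (dfact (suc k))) (poly-first k) ⟨
    eval (poly k) (ℕ→ℚ (suc k)) * ℕ→ℚ (dfact (suc k))        ∎
    where open ≡-Reasoning

  alpha-step : ∀ k → (∀ k′ → k′ < k → ∀ n → suc k′ ≤ n → AlphaValue k′ n) →
    ∀ n → suc k ≤ n → AlphaValue k n → AlphaValue k (suc n)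
  alpha-step k earlier n k<n αkn = begin
    ℕ→ℚ (α k (suc n))
      ≡⟨ cong ℕ→ℚ (α-suc k n (ℕ.<⇒≤ k<n)) ⟩
    ℕ→ℚ (α k n ℕ.* suc (2 ℕ.* n) ℕ.+ ℕΣ.∑< k T)
      ≡⟨ trans (ℕ→ℚ-+ (α k n ℕ.* suc (2 ℕ.* n)) (ℕΣ.∑< k T)) (cong₂ _+_ (ℕ→ℚ-* (α k n) (suc (2 ℕ.* n))) (ℕ→ℚ-∑ k T)) ⟩
    ℕ→ℚ (α k n) * ℕ→ℚ (suc (2 ℕ.* n)) + ∑[ i < k ] ℕ→ℚ (T i)
      ≡⟨ cong₂ _+_ (cong (_* ℕ→ℚ (suc (2 ℕ.* n))) αkn) (∑-cong k summand) ⟩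
    e * ℕ→ℚ (dfact n) * ℕ→ℚ (suc (2 ℕ.* n)) + ∑[ i < k ] (S i * D)
      ≡⟨ cong₂ _+_ (trans (solve 3 (λ a b c → a :* b :* c := a :* (c :* b)) refl e (ℕ→ℚ (dfact n)) (ℕ→ℚ (suc (2 ℕ.* n))))
                          (cong (e *_) (sym (ℕ→ℚ-* (suc (2 ℕ.* n)) (dfact n)))))
                   (sym (∑-distribʳ k D S)) ⟩
    e * D + polyStep k n * D
      ≡⟨ solve 3 (λ a b c → a :* c :+ b :* c := (a :+ b) :* c) refl e (polyStep k n) D ⟩
    (e + polyStep k n) * D
      ≡⟨ cong (_* D) (poly-suc-arg k n k<n) ⟨
    eval (poly k) (ℕ→ℚ (suc n)) * D ∎
    where
    open ≡-Reasoning
    e D : ℚ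
    e = eval (poly k) (ℕ→ℚ n)
    D = ℕ→ℚ (dfact (suc n))
    T : ℕ → ℕ
    T i = α (k ℕ.∸ suc i) (n ℕ.∸ suc i) ℕ.* ((suc (2 ℕ.* n) C suc (2 ℕ.* suc i)) ℕ.* euler (suc (2 ℕ.* suc i)))
    S : ℕ → ℚ
    S i = weight (suc i) (suc n) * eval (poly (k ℕ.∸ suc i)) (ℕ→ℚ (suc n ℕ.∸ suc i ℕ.∸ 1))
    summand : ∀ i → i < k → ℕ→ℚ (T i) ≡ S i * D
    summand i i<k = begin
      ℕ→ℚ (T i)                                    ≡⟨ ℕ→ℚ-* (α k′ n′) CE ⟩
      ℕ→ℚ (α k′ n′) * ℕ→ℚ CE                       ≡⟨ cong (_* ℕ→ℚ CE) (earlier k′ k′<k n′ k′<n′) ⟩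
      eval (poly k′) (ℕ→ℚ n′) * ℕ→ℚ (dfact n′) * ℕ→ℚ CE
        ≡⟨ solve 3 (λ a b c → a :* b :* c := a :* (c :* b)) refl (eval (poly k′) (ℕ→ℚ n′)) (ℕ→ℚ (dfact n′)) (ℕ→ℚ CE) ⟩
      eval (poly k′) (ℕ→ℚ n′) * (ℕ→ℚ CE * ℕ→ℚ (dfact n′))
        ≡⟨ cong (eval (poly k′) (ℕ→ℚ n′) *_) (trans (sym (ℕ→ℚ-* CE (dfact n′))) (sym (weight-dfact n (suc i) (ℕ.≤-trans i<k (ℕ.<⇒≤ k<n))))) ⟩
      eval (poly k′) (ℕ→ℚ n′) * (weight (suc i) (suc n) * D)
        ≡⟨ solve 3 (λ a b c → a :* (b :* c) := b :* a :* c) refl (eval (poly k′) (ℕ→ℚ n′)) (weight (suc i) (suc n)) D ⟩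
      weight (suc i) (suc n) * eval (poly k′) (ℕ→ℚ n′) * D
        ≡⟨ cong (λ z → weight (suc i) (suc n) * eval (poly k′) (ℕ→ℚ z) * D) (sym n′≡) ⟩
      S i * D ∎
      where
      k′ n′ CE : ℕ
      k′ = k ℕ.∸ suc i
      n′ = n ℕ.∸ suc i
      CE = (suc (2 ℕ.* n) C suc (2 ℕ.* suc i)) ℕ.* euler (suc (2 ℕ.* suc i))
      k′<k : k′ < k
      k′<k = subst (_≤ k) (ℕ.+-∸-assoc 1 i<k) (ℕ.m∸n≤m k i)
      k′<n′ : suc k′ ≤ n′
      k′<n′ = subst (_≤ n′) (ℕ.+-∸-assoc 1 i<k) (ℕ.∸-monoˡ-≤ (suc i) k<n)
      n′≡ : suc n ℕ.∸ suc i ℕ.∸ 1 ≡ n′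
      n′≡ = trans (ℕ.∸-+-assoc n i 1) (cong (n ℕ.∸_) (ℕ.+-comm i 1))

  alphaValue : ∀ k n → suc k ≤ n → AlphaValue k n
  alphaValue = <-rec (λ k → ∀ n → suc k ≤ n → AlphaValue k n) byArgument
    where
    byArgument : ∀ k → (∀ {k′} → k′ < k → ∀ n → suc k′ ≤ n → AlphaValue k′ n) → ∀ n → suc k ≤ n → AlphaValue k n
    byArgument k rec n k<n = subst (AlphaValue k) (ℕ.m+[n∸m]≡n k<n) (from (n ℕ.∸ suc k))
      where
      from : ∀ d → AlphaValue k (suc k ℕ.+ d)
      from zero    = subst (AlphaValue k) (sym (ℕ.+-identityʳ (suc k))) (alpha-first k)
      from (suc d) = subst (AlphaValue k) (sym (ℕ.+-suc (suc k) d))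
        (alpha-step k (λ k′ k′<k → rec k′<k) (suc k ℕ.+ d) (s≤s (ℕ.m≤m+n k d)) (from d))

  recursionTerm : ℕ → ℕ → ℕ → ℚ
  recursionTerm k j t = weight j t * eval (poly (k ℕ.∸ j)) (ℕ→ℚ (t ℕ.∸ j ℕ.∸ 1))

  poly-telescoped : ∀ k d → eval (poly k) (ℕ→ℚ (suc k ℕ.+ d)) ≡ leadTerm k + ∑[ i < k ] ∑[ r < d ] recursionTerm k (suc i) (k ℕ.+ 2 ℕ.+ r)
  poly-telescoped k zero = subst (λ z → eval (poly k) (ℕ→ℚ z) ≡ leadTerm k + ∑[ i < k ] 0ℚ) (sym (ℕ.+-identityʳ (suc k)))
    (trans (poly-first k) (trans (sym (+-identityʳ (leadTerm k))) (cong (leadTerm k +_) (sym (∑-zero k λ _ _ → refl)))))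
  poly-telescoped k (suc d) = begin
    eval (poly k) (ℕ→ℚ (suc k ℕ.+ suc d))                 ≡⟨ cong (λ z → eval (poly k) (ℕ→ℚ z)) (ℕ.+-suc (suc k) d) ⟩
    eval (poly k) (ℕ→ℚ (suc (suc k ℕ.+ d)))               ≡⟨ poly-suc-arg k (suc k ℕ.+ d) (s≤s (ℕ.m≤m+n k d)) ⟩
    eval (poly k) (ℕ→ℚ (suc k ℕ.+ d)) + polyStep k (suc k ℕ.+ d)
      ≡⟨ cong (_+ polyStep k (suc k ℕ.+ d)) (poly-telescoped k d) ⟩
    leadTerm k + S + polyStep k (suc k ℕ.+ d)             ≡⟨ +-assoc (leadTerm k) S _ ⟩
    leadTerm k + (S + polyStep k (suc k ℕ.+ d))
      ≡⟨ cong (λ z → leadTerm k + (S + z)) (∑-cong k λ i _ → cong (recursionTerm k (suc i)) (sym k+2+d≡)) ⟩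
    leadTerm k + (S + ∑[ i < k ] recursionTerm k (suc i) (k ℕ.+ 2 ℕ.+ d))
      ≡⟨ cong (leadTerm k +_) (sym (∑-distrib-+ k _ _)) ⟩
    leadTerm k + ∑[ i < k ] ∑[ r < suc d ] recursionTerm k (suc i) (k ℕ.+ 2 ℕ.+ r) ∎
    where
    open ≡-Reasoning
    S : ℚ
    S = ∑[ i < k ] ∑[ r < d ] recursionTerm k (suc i) (k ℕ.+ 2 ℕ.+ r)
    k+2+d≡ : k ℕ.+ 2 ℕ.+ d ≡ suc (suc k ℕ.+ d)
    k+2+d≡ = cong (ℕ._+ d) (ℕ.+-comm k 2)

  poly-recursion : ∀ k n → suc k ≤ n → eval (poly k) (ℕ→ℚ n) ≡ recRHS poly k n
  poly-recursion k n k<n = subst (λ z → eval (poly k) (ℕ→ℚ z) ≡ recRHS poly k z) (ℕ.m+[n∸m]≡n k<n) (begin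
    eval (poly k) (ℕ→ℚ (suc k ℕ.+ d))                                     ≡⟨ poly-telescoped k d ⟩
    leadTerm k + ∑[ i < k ] ∑[ r < d ] recursionTerm k (suc i) (k ℕ.+ 2 ℕ.+ r)
      ≡⟨ cong (leadTerm k +_) (∑-cong k λ i _ → cong (λ z → ∑[ r < z ] recursionTerm k (suc i) (k ℕ.+ 2 ℕ.+ r)) range) ⟨
    leadTerm k + ∑[ i < k ] ∑[ r < suc (suc k ℕ.+ d) ℕ.∸ (k ℕ.+ 2) ] recursionTerm k (suc i) (k ℕ.+ 2 ℕ.+ r)
      ≡⟨ cong (leadTerm k +_) (trans (sumFT≡∑ 1 k (λ j → sumFT (k ℕ.+ 2) (suc k ℕ.+ d) (recursionTerm k j)))
                              (∑-cong k λ i _ → sumFT≡∑ (k ℕ.+ 2) (suc k ℕ.+ d) (recursionTerm k (suc i)))) ⟨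
    recRHS poly k (suc k ℕ.+ d) ∎)
    where
    open ≡-Reasoning
    d : ℕ
    d = n ℕ.∸ suc k
    range : suc (suc k ℕ.+ d) ℕ.∸ (k ℕ.+ 2) ≡ d
    range = trans (cong (suc (suc k ℕ.+ d) ℕ.∸_) (ℕ.+-comm k 2)) (ℕ.m+n∸m≡n k d)

  A=-closedForm : ∀ k n → suc k ≤ n → ℕ→ℚ (A= n (n ℕ.+ k)) ≡ eval (poly k) (ℕ→ℚ n) * ℕ→ℚ (dfact n)
  A=-closedForm k n k<n = trans (cong ℕ→ℚ (A=≡upDownMmp n (n ℕ.+ k))) (alphaValue k n k<n)

  poly-zero : ∀ x → eval (poly 0) x ≡ 1ℚ
  poly-zero x = solve 1 (λ x → con 1ℚ :+ x :* con 0ℚ := con 1ℚ) refl x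

open import Defs
open import Data.Nat using (ℕ; suc; _≤_; _+_)
open import Data.Product using (Σ; _×_; _,_)
open import Data.Rational using (ℚ; _*_; 1ℚ)
open import Relation.Binary.PropositionalEquality using (_≡_)
open PolynomialFamily using (poly)
open ClosedForm using (A=-closedForm; poly-zero; poly-recursion)

theorem3p3 : Σ (ℕ → Poly) (λ p →
    ((k n : ℕ) → suc k ≤ n → ℕ→ℚ (A= n (n + k)) ≡ eval (p k) (ℕ→ℚ n) * ℕ→ℚ (dfact n))
    × ((x : ℚ) → eval (p 0) x ≡ 1ℚ)
    × ((k n : ℕ) → 1 ≤ k → suc k ≤ n → eval (p k) (ℕ→ℚ n) ≡ recRHS p k n))
theorem3p3 = poly , A=-closedForm , poly-zero , λ k n _ → poly-recursion k n
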